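{- Let $k\ge 3$ and let $f_1,f_2$ be two multisets on $\mathbb{Z}_2^{k-1}$ with distinguishing number $k$ that are in standard position, i.e. $\hat f_1(e_1)\cdots\hat f_1(e_{k-1})\hat f_1(h)\ne\hat f_2(e_1)\cdots\hat f_2(e_{k-1})\hat f_2(h)$. Then there exist distinct nonnegative integers $a,b$, positive integers $a_1,\dots,a_{k-1}$ and elements $x_1,x_2\in\mathbb{Z}_2^{k-1}$ such that \[x_1+f_1=f_{(a,b),(a_1,\ldots,a_{k-1})},\qquad x_2+f_2=f_{(b,a),(a_1,\ldots,a_{k-1})}.\]
   Context: A multiset on $\mathbb{Z}_2^m$ is a function $\phi:\mathbb{Z}_2^m\to\mathbb{N}$. Its $i$-deck is $\mathrm{deck}_i\phi(s_1,\dots,s_i)=\sum_{g\in\mathbb{Z}_2^m}\phi(g+s_1)\cdots\phi(g+s_i)$. Two multisets are $k$-indistinguishable if their $i$-decks agree for all $i\le k$, and $k$-distinguishable otherwise; their distinguishing number is the smallest $k$ for which they are $k$-distinguishable. The translate $z+f$ of a multiset $f$ by $z\in\mathbb{Z}_2^m$ is $(z+f)(y)=f(y+z)$. The Fourier transform is $\hat f(x)=\sum_{y}f(y)(-1)^{x_1y_1+\dots+x_my_m}$. Here $e_1,\dots,e_{k-1}$ is the standard basis of $\mathbb{Z}_2^{k-1}$ and $h=e_1+\dots+e_{k-1}$. Identifying $x\in\mathbb{Z}_2^{k-1}$ with $(x_1,\dots,x_{k-1})\in\{0,1\}^{k-1}$, for nonnegative integers $a,b$ and positive integers $a_i$, $f_{(a,b),(a_1,\ldots,a_{k-1})}(x)=a+\sum_i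 a_ix_i$ if $\sum_ix_i$ is even and $=b+\sum_i a_ix_i$ if $\sum_ix_i$ is odd. -}

module Defs where

open import Data.Nat using (ℕ; zero; suc; _+_; _*_; _≤_; _<_)
open import Data.Nat.Properties using (_≟_)
open import Data.Bool using (Bool; true; false; _xor_; _∧_; if_then_else_)
open import Data.Fin using (Fin)
import Data.Fin.Properties as FinP
open import Data.Vec using (Vec; []; _∷_; zipWith; tabulate; replicate; foldr)
import Data.Vec as Vec
open import Data.List using (List; []; _∷_; map; _++_)
open import Data.Nat.ListAction using (sum)
open import Data.Integer using (ℤ; +_; -_) renaming (_+_ to _+ℤ_; _*_ to _*ℤ_)
open import Relation.Nullary using (¬_; does)
open import Relation.Binary.PropositionalEquality using (_≡_)
open import Data.Product using (_×_)

Z2 : ℕ → Set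
Z2 m = Vec Bool m

_⊕_ : ∀ {m} → Z2 m → Z2 m → Z2 m
x ⊕ y = zipWith _xor_ x y

allZ2 : (m : ℕ) → List (Z2 m)
allZ2 zero = [] ∷ []
allZ2 (suc m) = map (false ∷_) (allZ2 m) ++ map (true ∷_) (allZ2 m)

Multiset : ℕ → Set
Multiset m = Z2 m → ℕ

prodAt : ∀ {m i} → Multiset m → Z2 m → Vec (Z2 m) i → ℕ
prodAt φ g [] = 1
prodAt φ g (s ∷ ss) = φ (g ⊕ s) * prodAt φ g ss

deck : ∀ {m} (i : ℕ) → Multiset m → Vec (Z2 m) i → ℕ
deck i φ s = sum (map (λ g → prodAt φ g s) (allZ2 _))

Indistinguishable : ∀ {m} → ℕ → Multiset m → Multiset m → Set
Indistinguishable k φ ψ = ∀ i → i ≤ k → (s : Vec (Z2 _) i) → deck i φ s ≡ deck i ψ s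

Distinguishable : ∀ {m} → ℕ → Multiset m → Multiset m → Set
Distinguishable k φ ψ = ¬ Indistinguishable k φ ψ

DistinguishingNumber : ∀ {m} → Multiset m → Multiset m → ℕ → Set
DistinguishingNumber φ ψ k =
  Distinguishable k φ ψ × (∀ j → j < k → ¬ Distinguishable j φ ψ)

translate : ∀ {m} → Z2 m → Multiset m → Multiset m
translate z f y = f (y ⊕ z)

bitNat : Bool → ℕ
bitNat true = 1
bitNat false = 0

dot : ∀ {m} → Z2 m → Z2 m → Bool
dot x y = foldr _ _xor_ false (zipWith _∧_ x y)

sign : Bool → ℤ
sign false = + 1
sign true = - (+ 1)

fourier : ∀ {m} → Multiset m → Z2 m → ℤ
fourier f x = Data.List.foldr _+ℤ_ (+ 0) (map (λ y → (+ f y) *ℤ sign (dot x y)) (allZ2 _))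

basis : ∀ {m} → Fin m → Z2 m
basis i = tabulate (λ j → does (i FinP.≟ j))

hvec : ∀ {m} → Z2 m
hvec = replicate _ true

fourierProduct : ∀ {m} → Multiset m → ℤ
fourierProduct {m} f = Vec.foldr _ _*ℤ_ (fourier f hvec) (tabulate (λ i → fourier f (basis i)))

parity : ∀ {m} → Z2 m → Bool
parity x = foldr _ _xor_ false x

weighted : ∀ {m} → Vec ℕ m → Z2 m → ℕ
weighted as x = Vec.sum (zipWith (λ a b → a * bitNat b) as x)

fShape : ∀ {m} → ℕ → ℕ → Vec ℕ m → Multiset m
fShape a b as x = (if parity x then b else a) + weighted as x

-- Summing the i-deck of f against the character χ_{x₁} ⊗ ⋯ ⊗ χ_{xᵢ} gives 2ᵐ f̂(x₁)⋯f̂(xᵢ) whenever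
-- x₁ + ⋯ + xᵢ = 0, so two (k-1)-indistinguishable multisets on Z₂ᵐ (m = k - 1) have the same products
-- of Fourier coefficients along all zero-sum tuples of length at most m.  Tuples of length 1 and 2
-- give f̂₁(0) = f̂₂(0) and f̂₁² = f̂₂².  For x of weight w with 2 ≤ w < m, the tuples
-- (x, eᵢ for i ∈ supp x) and (x, h, eⱼ for j ∉ supp x) multiply to f̂(x)² f̂(e₁)⋯f̂(eₘ)f̂(h), so standard
-- position forces f̂₁(x) = f̂₂(x) = 0; it also forces every f̂(eᵢ) ≠ 0.  After translating each fⱼ so
-- that all f̂ⱼ(eᵢ) are negative, the two spectra agree at 0 and at the eᵢ, vanish off {0, h, e₁, …, eₘ},
-- and are opposite and nonzero at h.  Fourier inversion then writes 2ᵐ gⱼ(y) as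
-- ĝ(0) ± ĝ₁(h) (-1)^{|y|} + Σᵢ ĝ(eᵢ) (-1)^{yᵢ}, which is the claimed shape with aᵢ = -2 ĝ(eᵢ) / 2ᵐ.

module Submission where
open import Defs
open import Data.Nat as ℕ using (ℕ; zero; suc; _≤_; _<_; _∸_; _^_; z≤n; s≤s)
import Data.Nat.Properties as ℕ
import Data.Bool as Bool
open import Data.Bool using (Bool; true; false; _xor_; _∧_; not; if_then_else_)
open import Data.Bool.Properties
  using (xor-comm; xor-assoc; xor-same; xor-identityʳ; ∧-distribˡ-xor; ∧-comm; ∧-zeroʳ; xor-∧-commutativeRing)
open import Data.Fin as Fin using (Fin; zero; suc)
import Data.Fin.Properties as Fin
open import Data.Vec as Vec using (Vec; []; _∷_; tabulate; replicate; lookup)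
import Data.Vec.Properties as Vec
open import Data.Vec.Relation.Unary.All using (All)
import Data.Vec.Relation.Unary.All.Properties as AllVec
open import Data.List as List using (List; []; _∷_; _++_; allFin)
import Data.List.Properties as List
open import Data.Nat.ListAction using (sum)
open import Data.List.Membership.Propositional using (_∈_; _∉_)
open import Data.List.Membership.Propositional.Properties using (∈-map⁺; ∈-map⁻; ∈-++⁺ˡ; ∈-++⁺ʳ; ∈-tabulate⁺)
open import Data.List.Relation.Unary.Any using (here; there)
import Data.List.Relation.Unary.All as ListAll
import Data.List.Relation.Unary.All.Properties as ListAll
open import Data.List.Relation.Unary.AllPairs using ([]; _∷_)
open import Data.List.Relation.Unary.Unique.Propositional using (Unique)
open import Data.List.Relation.Binary.Disjoint.Propositional using (Disjoint)
import Data.List.Relation.Unary.Unique.Propositional.Properties as Unique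
open import Data.Integer as ℤ using (ℤ; +_; -[1+_]; -_; 0ℤ; 1ℤ; ∣_∣)
  renaming (_+_ to _+ℤ_; _*_ to _*ℤ_; _-_ to _-ℤ_)
import Data.Integer.Properties as ℤ
open import Data.Integer.Tactic.RingSolver using (solve-∀)
open import Data.Product using (_×_; _,_; ∃-syntax; proj₁; proj₂)
open import Data.Sum using (_⊎_; inj₁; inj₂)
open import Function using (_∘_; id; case_of_)
open import Algebra using (CommutativeRing)
import Algebra.Properties.CommutativeSemigroup as CommutativeSemigroupProperties
open import Relation.Nullary using (¬_; yes; no; does; contradiction)
open import Relation.Nullary.Decidable using (decidable-stable; dec-true; dec-false)
open import Relation.Binary.PropositionalEquality
open import Relation.Binary.Definitions using (DecidableEquality)
open ≡-Reasoning

private variable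
  A B : Set

-- This is literally the sum in the definition of fourier, so fourier f x unfolds to ∑[ y ∈ allZ2 m ] + f y *ℤ χ x y.
∑ : List A → (A → ℤ) → ℤ
∑ l F = List.foldr _+ℤ_ 0ℤ (List.map F l)

infix 5 ∑
syntax ∑ l (λ x → e) = ∑[ x ∈ l ] e

∑-zero : (l : List A) → ∑[ _ ∈ l ] 0ℤ ≡ 0ℤ
∑-zero []      = refl
∑-zero (x ∷ l) = trans (ℤ.+-identityˡ _) (∑-zero l)

∑-cong : (l : List A) {F G : A → ℤ} → (∀ x → F x ≡ G x) → ∑ l F ≡ ∑ l G
∑-cong []      F≗G = refl
∑-cong (x ∷ l) F≗G = cong₂ _+ℤ_ (F≗G x) (∑-cong l F≗G)

∑-++ : (l k : List A) (F : A → ℤ) → ∑ (l ++ k) F ≡ ∑ l F +ℤ ∑ k F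
∑-++ []      k F = sym (ℤ.+-identityˡ _)
∑-++ (x ∷ l) k F = trans (cong (F x +ℤ_) (∑-++ l k F)) (sym (ℤ.+-assoc (F x) _ _))

∑-map : (l : List B) (g : B → A) (F : A → ℤ) → ∑ (List.map g l) F ≡ ∑[ x ∈ l ] F (g x)
∑-map []      g F = refl
∑-map (x ∷ l) g F = cong (F (g x) +ℤ_) (∑-map l g F)

∑-+ : (l : List A) (F G : A → ℤ) → ∑[ x ∈ l ] (F x +ℤ G x) ≡ ∑ l F +ℤ ∑ l G
∑-+ []      F G = refl
∑-+ (x ∷ l) F G = trans (cong (F x +ℤ G x +ℤ_) (∑-+ l F G)) (interchange (F x) (G x) _ _)
  where
  interchange : ∀ a b c d → (a +ℤ b) +ℤ (c +ℤ d) ≡ (a +ℤ c) +ℤ (b +ℤ d)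
  interchange = solve-∀

∑-*ˡ : (l : List A) (c : ℤ) (F : A → ℤ) → ∑[ x ∈ l ] (c *ℤ F x) ≡ c *ℤ ∑ l F
∑-*ˡ []      c F = sym (ℤ.*-zeroʳ c)
∑-*ˡ (x ∷ l) c F = trans (cong (c *ℤ F x +ℤ_) (∑-*ˡ l c F)) (sym (ℤ.*-distribˡ-+ c (F x) _))

∑-*ʳ : (l : List A) (c : ℤ) (F : A → ℤ) → ∑[ x ∈ l ] (F x *ℤ c) ≡ ∑ l F *ℤ c
∑-*ʳ l c F = begin
  ∑[ x ∈ l ] (F x *ℤ c)  ≡⟨ ∑-cong l (λ x → ℤ.*-comm (F x) c) ⟩
  ∑[ x ∈ l ] (c *ℤ F x)  ≡⟨ ∑-*ˡ l c F ⟩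
  c *ℤ ∑ l F             ≡⟨ ℤ.*-comm c _ ⟩
  ∑ l F *ℤ c             ∎

∑-comm : (l : List A) (k : List B) (F : A → B → ℤ) →
         ∑[ x ∈ l ] ∑[ y ∈ k ] F x y ≡ ∑[ y ∈ k ] ∑[ x ∈ l ] F x y
∑-comm []      k F = sym (∑-zero k)
∑-comm (x ∷ l) k F = trans (cong (∑ k (F x) +ℤ_) (∑-comm l k F)) (sym (∑-+ k (F x) _))

∑-pos : (l : List A) (F : A → ℕ) → + sum (List.map F l) ≡ ∑[ x ∈ l ] + F x
∑-pos []      F = refl
∑-pos (x ∷ l) F = trans (ℤ.pos-+ (F x) _) (cong (+ F x +ℤ_) (∑-pos l F))

∑-tabulate : ∀ {n} (g : Fin n → A) (F : A → ℤ) → ∑ (List.tabulate g) F ≡ ∑[ i ∈ allFin n ] F (g i)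
∑-tabulate g F = cong (List.foldr _+ℤ_ 0ℤ) (trans (List.map-tabulate g F) (sym (List.map-tabulate id (F ∘ g))))

module Indicator {A : Set} (_≟_ : DecidableEquality A) where

  open import Data.List.Membership.DecPropositional _≟_ using (_∈?_)

  δ : A → A → ℤ
  δ x y = if does (x ≟ y) then 1ℤ else 0ℤ

  δ-self : ∀ x → δ x x ≡ 1ℤ
  δ-self x with x ≟ x
  ... | yes _  = refl
  ... | no x≢x = contradiction refl x≢x

  δ-≢ : ∀ {x y} → x ≢ y → δ x y ≡ 0ℤ
  δ-≢ {x} {y} x≢y with x ≟ y
  ... | yes x≡y = contradiction x≡y x≢y
  ... | no _    = refl

  δ-comm : ∀ x y → δ x y ≡ δ y x
  δ-comm x y with x ≟ y
  ... | yes refl = sym (δ-self x)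
  ... | no x≢y   = sym (δ-≢ (x≢y ∘ sym))

  ∑-δ-∉ : ∀ {x} (l : List A) (F : A → ℤ) → x ∉ l → ∑[ y ∈ l ] δ x y *ℤ F y ≡ 0ℤ
  ∑-δ-∉ []      F x∉l = refl
  ∑-δ-∉ {x} (y ∷ l) F x∉l = begin
    δ x y *ℤ F y +ℤ (∑[ z ∈ l ] δ x z *ℤ F z)
      ≡⟨ cong₂ (λ d s → d *ℤ F y +ℤ s) (δ-≢ (x∉l ∘ here)) (∑-δ-∉ l F (x∉l ∘ there)) ⟩
    0ℤ                                         ∎

  ∑-δ-∈ : ∀ {x} {l : List A} (F : A → ℤ) → Unique l → x ∈ l → ∑[ y ∈ l ] δ x y *ℤ F y ≡ F x
  ∑-δ-∈ {x} {y ∷ l} F (y≢l ∷ _) (here refl) = begin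
    δ x x *ℤ F x +ℤ (∑[ z ∈ l ] δ x z *ℤ F z)  ≡⟨ cong₂ (λ d s → d *ℤ F x +ℤ s) (δ-self x) (∑-δ-∉ l F x∉l) ⟩
    1ℤ *ℤ F x +ℤ 0ℤ                            ≡⟨ trans (ℤ.+-identityʳ _) (ℤ.*-identityˡ _) ⟩
    F x                                        ∎
    where
    x∉l : x ∉ l
    x∉l x∈l = ListAll.lookup y≢l x∈l refl
  ∑-δ-∈ {x} {y ∷ l} F (y≢l ∷ l-unique) (there x∈l) = begin
    δ x y *ℤ F y +ℤ (∑[ z ∈ l ] δ x z *ℤ F z)
      ≡⟨ cong₂ (λ d s → d *ℤ F y +ℤ s) (δ-≢ (ListAll.lookup y≢l x∈l ∘ sym)) (∑-δ-∈ F l-unique x∈l) ⟩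
    0ℤ *ℤ F y +ℤ F x
      ≡⟨ ℤ.+-identityˡ _ ⟩
    F x
      ∎

  ∑-supported : (U L : List A) (F : A → ℤ) → Unique U → (∀ x → x ∈ U) → Unique L →
                (∀ x → x ∉ L → F x ≡ 0ℤ) → ∑ U F ≡ ∑ L F
  ∑-supported U L F U-unique U-complete L-unique F-vanishes = begin
    ∑[ x ∈ U ] F x                            ≡⟨ ∑-cong U expand ⟩
    ∑[ x ∈ U ] ∑[ y ∈ L ] δ x y *ℤ F y        ≡⟨ ∑-comm U L (λ x y → δ x y *ℤ F y) ⟩
    ∑[ y ∈ L ] ∑[ x ∈ U ] δ x y *ℤ F y        ≡⟨ ∑-cong L collapse ⟩
    ∑[ y ∈ L ] F y                            ∎
    where
    expand : ∀ x → F x ≡ ∑[ y ∈ L ] δ x y *ℤ F y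
    expand x with x ∈? L
    ... | yes x∈L = sym (∑-δ-∈ F L-unique x∈L)
    ... | no  x∉L = trans (F-vanishes x x∉L) (sym (∑-δ-∉ L F x∉L))
    collapse : ∀ y → ∑[ x ∈ U ] δ x y *ℤ F y ≡ F y
    collapse y = trans (∑-cong U (λ x → cong (_*ℤ F y) (δ-comm x y))) (∑-δ-∈ (λ _ → F y) U-unique (U-complete y))

zeros : ∀ {m} → Z2 m
zeros = replicate _ false

_≟ᶻ_ : ∀ {m} → DecidableEquality (Z2 m)
_≟ᶻ_ = Vec.≡-dec Bool._≟_

⊕-comm : ∀ {m} (x y : Z2 m) → x ⊕ y ≡ y ⊕ x
⊕-comm = Vec.zipWith-comm xor-comm

⊕-assoc : ∀ {m} (x y z : Z2 m) → (x ⊕ y) ⊕ z ≡ x ⊕ (y ⊕ z)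
⊕-assoc = Vec.zipWith-assoc xor-assoc

⊕-identityˡ : ∀ {m} (x : Z2 m) → zeros ⊕ x ≡ x
⊕-identityˡ = Vec.zipWith-identityˡ (λ _ → refl)

⊕-identityʳ : ∀ {m} (x : Z2 m) → x ⊕ zeros ≡ x
⊕-identityʳ = Vec.zipWith-identityʳ xor-identityʳ

⊕-self : ∀ {m} (x : Z2 m) → x ⊕ x ≡ zeros
⊕-self []      = refl
⊕-self (b ∷ x) = cong₂ _∷_ (xor-same b) (⊕-self x)

⊕-cancelˡ : ∀ {m} (x y : Z2 m) → x ⊕ (x ⊕ y) ≡ y
⊕-cancelˡ x y = begin
  x ⊕ (x ⊕ y)  ≡⟨ sym (⊕-assoc x x y) ⟩
  (x ⊕ x) ⊕ y  ≡⟨ cong (_⊕ y) (⊕-self x) ⟩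
  zeros ⊕ y    ≡⟨ ⊕-identityˡ y ⟩
  y            ∎

basis-zero : ∀ {n} → basis {suc n} zero ≡ true ∷ zeros
basis-zero {n} = cong (true ∷_) (tabulate-false n)
  where
  tabulate-false : ∀ n → tabulate {n = n} (λ _ → false) ≡ zeros
  tabulate-false zero    = refl
  tabulate-false (suc n) = cong (false ∷_) (tabulate-false n)

basis-injective : ∀ {n} {i j : Fin n} → basis i ≡ basis j → i ≡ j
basis-injective {i = i} {j} eᵢ≡eⱼ = decidable-stable (i Fin.≟ j) (λ i≢j → true≢false (begin
  true                 ≡⟨ sym (dec-true (i Fin.≟ i) refl) ⟩
  does (i Fin.≟ i)     ≡⟨ sym (Vec.lookup∘tabulate _ i) ⟩
  lookup (basis i) i   ≡⟨ cong (λ v → lookup v i) eᵢ≡eⱼ ⟩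
  lookup (basis j) i   ≡⟨ Vec.lookup∘tabulate _ i ⟩
  does (j Fin.≟ i)     ≡⟨ dec-false (j Fin.≟ i) (i≢j ∘ sym) ⟩
  false                ∎))
  where
  true≢false : true ≢ false
  true≢false ()

∈-allZ2 : ∀ {m} (x : Z2 m) → x ∈ allZ2 m
∈-allZ2 []          = here refl
∈-allZ2 (false ∷ x) = ∈-++⁺ˡ (∈-map⁺ (false ∷_) (∈-allZ2 x))
∈-allZ2 (true ∷ x)  = ∈-++⁺ʳ (List.map (false ∷_) (allZ2 _)) (∈-map⁺ (true ∷_) (∈-allZ2 x))

allZ2-unique : ∀ m → Unique (allZ2 m)
allZ2-unique zero    = ListAll.[] ∷ []
allZ2-unique (suc m) =
  Unique.++⁺ (Unique.map⁺ Vec.∷-injectiveʳ (allZ2-unique m)) (Unique.map⁺ Vec.∷-injectiveʳ (allZ2-unique m)) disjoint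
  where
  disjoint : Disjoint (List.map (false ∷_) (allZ2 m)) (List.map (true ∷_) (allZ2 m))
  disjoint (v∈₀ , v∈₁) with ∈-map⁻ (false ∷_) v∈₀ | ∈-map⁻ (true ∷_) v∈₁
  ... | _ , _ , refl | _ , _ , ()

∑-allZ2-suc : ∀ m (F : Z2 (suc m) → ℤ) →
              ∑ (allZ2 (suc m)) F ≡ (∑[ s ∈ allZ2 m ] F (false ∷ s)) +ℤ (∑[ s ∈ allZ2 m ] F (true ∷ s))
∑-allZ2-suc m F = trans (∑-++ (List.map (false ∷_) (allZ2 m)) _ F)
                        (cong₂ _+ℤ_ (∑-map (allZ2 m) (false ∷_) F) (∑-map (allZ2 m) (true ∷_) F))

∑-translate : ∀ m (g : Z2 m) (F : Z2 m → ℤ) → ∑[ s ∈ allZ2 m ] F (g ⊕ s) ≡ ∑ (allZ2 m) F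
∑-translate zero    []      F = refl
∑-translate (suc m) (b ∷ g) F = begin
  ∑[ s ∈ allZ2 (suc m) ] F ((b ∷ g) ⊕ s)
    ≡⟨ ∑-allZ2-suc m _ ⟩
  (∑[ s ∈ allZ2 m ] F ((b xor false) ∷ (g ⊕ s))) +ℤ (∑[ s ∈ allZ2 m ] F ((b xor true) ∷ (g ⊕ s)))
    ≡⟨ cong₂ _+ℤ_ (∑-translate m g (F ∘ ((b xor false) ∷_))) (∑-translate m g (F ∘ ((b xor true) ∷_))) ⟩
  (∑[ s ∈ allZ2 m ] F ((b xor false) ∷ s)) +ℤ (∑[ s ∈ allZ2 m ] F ((b xor true) ∷ s))
    ≡⟨ swap-halves b ⟩
  (∑[ s ∈ allZ2 m ] F (false ∷ s)) +ℤ (∑[ s ∈ allZ2 m ] F (true ∷ s))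
    ≡⟨ sym (∑-allZ2-suc m F) ⟩
  ∑ (allZ2 (suc m)) F
    ∎
  where
  swap-halves : ∀ b → (∑[ s ∈ allZ2 m ] F ((b xor false) ∷ s)) +ℤ (∑[ s ∈ allZ2 m ] F ((b xor true) ∷ s))
                    ≡ (∑[ s ∈ allZ2 m ] F (false ∷ s)) +ℤ (∑[ s ∈ allZ2 m ] F (true ∷ s))
  swap-halves false = refl
  swap-halves true  = ℤ.+-comm (∑[ s ∈ allZ2 m ] F (true ∷ s)) _

∑-allZ2-one : ∀ m → ∑[ _ ∈ allZ2 m ] 1ℤ ≡ + 2 ^ m
∑-allZ2-one zero    = refl
∑-allZ2-one (suc m) = begin
  ∑[ _ ∈ allZ2 (suc m) ] 1ℤ                            ≡⟨ ∑-allZ2-suc m (λ _ → 1ℤ) ⟩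
  (∑[ _ ∈ allZ2 m ] 1ℤ) +ℤ (∑[ _ ∈ allZ2 m ] 1ℤ)      ≡⟨ cong₂ _+ℤ_ (∑-allZ2-one m) (∑-allZ2-one m) ⟩
  + 2 ^ m +ℤ + 2 ^ m                                   ≡⟨ sym (ℤ.pos-+ (2 ^ m) (2 ^ m)) ⟩
  + (2 ^ m ℕ.+ 2 ^ m)                                  ≡⟨ cong +_ (cong (2 ^ m ℕ.+_) (sym (ℕ.+-identityʳ (2 ^ m)))) ⟩
  + 2 ^ suc m                                          ∎

χ : ∀ {m} → Z2 m → Z2 m → ℤ
χ x y = sign (dot x y)

sign-xor : ∀ a b → sign (a xor b) ≡ sign a *ℤ sign b
sign-xor false b     = sym (ℤ.*-identityˡ (sign b))
sign-xor true  false = refl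
sign-xor true  true  = refl

sign-sq : ∀ a → sign a *ℤ sign a ≡ 1ℤ
sign-sq false = refl
sign-sq true  = refl

dot-⊕ʳ : ∀ {m} (x y z : Z2 m) → dot x (y ⊕ z) ≡ dot x y xor dot x z
dot-⊕ʳ []      []      []      = refl
dot-⊕ʳ (a ∷ x) (b ∷ y) (c ∷ z) = begin
  (a ∧ (b xor c)) xor dot x (y ⊕ z)                 ≡⟨ cong₂ _xor_ (∧-distribˡ-xor a b c) (dot-⊕ʳ x y z) ⟩
  ((a ∧ b) xor (a ∧ c)) xor (dot x y xor dot x z)   ≡⟨ XorProps.interchange (a ∧ b) (a ∧ c) _ _ ⟩
  ((a ∧ b) xor dot x y) xor ((a ∧ c) xor dot x z)   ∎
  where module XorProps = CommutativeSemigroupProperties (CommutativeRing.+-commutativeSemigroup xor-∧-commutativeRing)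

dot-comm : ∀ {m} (x y : Z2 m) → dot x y ≡ dot y x
dot-comm []      []      = refl
dot-comm (a ∷ x) (b ∷ y) = cong₂ _xor_ (∧-comm a b) (dot-comm x y)

dot-zerosʳ : ∀ {m} (x : Z2 m) → dot x zeros ≡ false
dot-zerosʳ []      = refl
dot-zerosʳ (a ∷ x) = cong₂ _xor_ (∧-zeroʳ a) (dot-zerosʳ x)

dot-hvec : ∀ {m} (y : Z2 m) → dot hvec y ≡ parity y
dot-hvec []      = refl
dot-hvec (b ∷ y) = cong (b xor_) (dot-hvec y)

dot-basis : ∀ {m} (i : Fin m) (y : Z2 m) → dot (basis i) y ≡ lookup y i
dot-basis {suc m} zero    (b ∷ y) = begin
  dot (basis zero) (b ∷ y)  ≡⟨ cong (λ v → dot v (b ∷ y)) (basis-zero {m}) ⟩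
  b xor dot zeros y         ≡⟨ cong (b xor_) (trans (dot-comm zeros y) (dot-zerosʳ y)) ⟩
  b xor false               ≡⟨ xor-identityʳ b ⟩
  b                         ∎
dot-basis         (suc i) (b ∷ y) = dot-basis i y

χ-comm : ∀ {m} (x y : Z2 m) → χ x y ≡ χ y x
χ-comm x y = cong sign (dot-comm x y)

χ-⊕ʳ : ∀ {m} (x y z : Z2 m) → χ x (y ⊕ z) ≡ χ x y *ℤ χ x z
χ-⊕ʳ x y z = trans (cong sign (dot-⊕ʳ x y z)) (sign-xor (dot x y) (dot x z))

χ-⊕ˡ : ∀ {m} (x y z : Z2 m) → χ (x ⊕ y) z ≡ χ x z *ℤ χ y z
χ-⊕ˡ x y z = trans (χ-comm (x ⊕ y) z) (trans (χ-⊕ʳ z x y) (cong₂ _*ℤ_ (χ-comm z x) (χ-comm z y)))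

χ-zerosʳ : ∀ {m} (x : Z2 m) → χ x zeros ≡ 1ℤ
χ-zerosʳ x = cong sign (dot-zerosʳ x)

χ-zerosˡ : ∀ {m} (y : Z2 m) → χ zeros y ≡ 1ℤ
χ-zerosˡ y = trans (χ-comm zeros y) (χ-zerosʳ y)

χ-sq : ∀ {m} (x y : Z2 m) → χ x y *ℤ χ x y ≡ 1ℤ
χ-sq x y = sign-sq (dot x y)

∑-χ-zeros : ∀ m → ∑[ x ∈ allZ2 m ] χ x zeros ≡ + 2 ^ m
∑-χ-zeros m = trans (∑-cong (allZ2 m) χ-zerosʳ) (∑-allZ2-one m)

∑-χ-≢zeros : ∀ m {w : Z2 m} → w ≢ zeros → ∑[ x ∈ allZ2 m ] χ x w ≡ 0ℤ
∑-χ-≢zeros zero    {[]}        w≢0 = contradiction refl w≢0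
∑-χ-≢zeros (suc m) {false ∷ w} w≢0 = begin
  ∑[ x ∈ allZ2 (suc m) ] χ x (false ∷ w)              ≡⟨ ∑-allZ2-suc m _ ⟩
  (∑[ x ∈ allZ2 m ] χ x w) +ℤ (∑[ x ∈ allZ2 m ] χ x w) ≡⟨ cong₂ _+ℤ_ ∑χ≡0 ∑χ≡0 ⟩
  0ℤ                                                   ∎
  where
  ∑χ≡0 : ∑[ x ∈ allZ2 m ] χ x w ≡ 0ℤ
  ∑χ≡0 = ∑-χ-≢zeros m (w≢0 ∘ cong (false ∷_))
∑-χ-≢zeros (suc m) {true ∷ w}  w≢0 = begin
  ∑[ x ∈ allZ2 (suc m) ] χ x (true ∷ w)          ≡⟨ ∑-allZ2-suc m _ ⟩
  Σχ +ℤ (∑[ x ∈ allZ2 m ] sign (not (dot x w)))  ≡⟨ cong (Σχ +ℤ_) (∑-cong (allZ2 m) (λ x → sign-xor true (dot x w))) ⟩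
  Σχ +ℤ (∑[ x ∈ allZ2 m ] - 1ℤ *ℤ χ x w)         ≡⟨ cong (Σχ +ℤ_) (∑-*ˡ (allZ2 m) (- 1ℤ) (λ x → χ x w)) ⟩
  Σχ +ℤ - 1ℤ *ℤ Σχ                               ≡⟨ cancel Σχ ⟩
  0ℤ                                             ∎
  where
  Σχ = ∑[ x ∈ allZ2 m ] χ x w
  cancel : ∀ s → s +ℤ - 1ℤ *ℤ s ≡ 0ℤ
  cancel = solve-∀

fourier-shift : ∀ {m} (f : Multiset m) (y g : Z2 m) →
                ∑[ s ∈ allZ2 m ] + f (g ⊕ s) *ℤ χ y s ≡ χ y g *ℤ fourier f y
fourier-shift {m} f y g = begin
  ∑[ s ∈ allZ2 m ] + f (g ⊕ s) *ℤ χ y s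
    ≡⟨ ∑-cong (allZ2 m) (λ s → cong (λ v → + f (g ⊕ s) *ℤ χ y v) (sym (⊕-cancelˡ g s))) ⟩
  ∑[ s ∈ allZ2 m ] + f (g ⊕ s) *ℤ χ y (g ⊕ (g ⊕ s))
    ≡⟨ ∑-translate m g (λ s → + f s *ℤ χ y (g ⊕ s)) ⟩
  ∑[ s ∈ allZ2 m ] + f s *ℤ χ y (g ⊕ s)
    ≡⟨ ∑-cong (allZ2 m) (λ s → trans (cong (+ f s *ℤ_) (χ-⊕ʳ y g s)) (rearrange (+ f s) (χ y g) (χ y s))) ⟩
  ∑[ s ∈ allZ2 m ] χ y g *ℤ (+ f s *ℤ χ y s)
    ≡⟨ ∑-*ˡ (allZ2 m) (χ y g) _ ⟩
  χ y g *ℤ fourier f y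
    ∎
  where
  rearrange : ∀ a b c → a *ℤ (b *ℤ c) ≡ b *ℤ (a *ℤ c)
  rearrange = solve-∀

fourier-translate : ∀ {m} (z : Z2 m) (f : Multiset m) (x : Z2 m) →
                    fourier (translate z f) x ≡ χ x z *ℤ fourier f x
fourier-translate {m} z f x =
  trans (∑-cong (allZ2 m) (λ y → cong (λ v → + f v *ℤ χ x y) (⊕-comm y z))) (fourier-shift f x z)

fourier-translate-zeros : ∀ {m} (z : Z2 m) (f : Multiset m) → fourier (translate z f) zeros ≡ fourier f zeros
fourier-translate-zeros z f = trans (fourier-translate z f zeros) (trans (cong (_*ℤ fourier f zeros) (χ-zerosˡ z)) (ℤ.*-identityˡ _))

fourier-translate-sq : ∀ {m} (z : Z2 m) (f : Multiset m) x →
  fourier (translate z f) x *ℤ fourier (translate z f) x ≡ fourier f x *ℤ fourier f x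
fourier-translate-sq z f x = begin
  fourier (translate z f) x *ℤ fourier (translate z f) x   ≡⟨ cong₂ _*ℤ_ (fourier-translate z f x) (fourier-translate z f x) ⟩
  (χ x z *ℤ fourier f x) *ℤ (χ x z *ℤ fourier f x)         ≡⟨ rearrange (χ x z) (fourier f x) ⟩
  (χ x z *ℤ χ x z) *ℤ (fourier f x *ℤ fourier f x)         ≡⟨ trans (cong (_*ℤ _) (χ-sq x z)) (ℤ.*-identityˡ _) ⟩
  fourier f x *ℤ fourier f x                               ∎
  where
  rearrange : ∀ s a → (s *ℤ a) *ℤ (s *ℤ a) ≡ (s *ℤ s) *ℤ (a *ℤ a)
  rearrange = solve-∀

fourier-inversion : ∀ {m} (f : Multiset m) (y : Z2 m) → ∑[ x ∈ allZ2 m ] fourier f x *ℤ χ x y ≡ + 2 ^ m *ℤ + f y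
fourier-inversion {m} f y = begin
  ∑[ x ∈ U ] fourier f x *ℤ χ x y
    ≡⟨ ∑-cong U (λ x → trans (sym (∑-*ʳ U (χ x y) _)) (∑-cong U (λ z → merge x z))) ⟩
  ∑[ x ∈ U ] ∑[ z ∈ U ] + f z *ℤ χ x (z ⊕ y)
    ≡⟨ ∑-comm U U _ ⟩
  ∑[ z ∈ U ] ∑[ x ∈ U ] + f z *ℤ χ x (z ⊕ y)
    ≡⟨ ∑-cong U (λ z → ∑-*ˡ U (+ f z) _) ⟩
  ∑[ z ∈ U ] + f z *ℤ Σχ (z ⊕ y)
    ≡⟨ sym (∑-translate m y (λ z → + f z *ℤ Σχ (z ⊕ y))) ⟩
  ∑[ z ∈ U ] + f (y ⊕ z) *ℤ Σχ ((y ⊕ z) ⊕ y)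
    ≡⟨ ∑-cong U (λ z → cong (λ v → + f (y ⊕ z) *ℤ Σχ v) (trans (⊕-comm (y ⊕ z) y) (⊕-cancelˡ y z))) ⟩
  ∑[ z ∈ U ] + f (y ⊕ z) *ℤ Σχ z
    ≡⟨ Indicator.∑-supported _≟ᶻ_ U (zeros ∷ []) _ (allZ2-unique m) ∈-allZ2 (ListAll.[] ∷ []) Σχ-vanishes ⟩
  + f (y ⊕ zeros) *ℤ Σχ zeros +ℤ 0ℤ
    ≡⟨ cong₂ (λ v o → + f v *ℤ o +ℤ 0ℤ) (⊕-identityʳ y) (∑-χ-zeros m) ⟩
  + f y *ℤ + 2 ^ m +ℤ 0ℤ
    ≡⟨ trans (ℤ.+-identityʳ _) (ℤ.*-comm (+ f y) _) ⟩
  + 2 ^ m *ℤ + f y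
    ∎
  where
  U = allZ2 m
  Σχ : Z2 m → ℤ
  Σχ w = ∑[ x ∈ U ] χ x w
  merge : ∀ x z → + f z *ℤ χ x z *ℤ χ x y ≡ + f z *ℤ χ x (z ⊕ y)
  merge x z = trans (ℤ.*-assoc (+ f z) _ _) (cong (+ f z *ℤ_) (sym (χ-⊕ʳ x z y)))
  Σχ-vanishes : ∀ z → z ∉ zeros ∷ [] → + f (y ⊕ z) *ℤ Σχ z ≡ 0ℤ
  Σχ-vanishes z z∉ = trans (cong (+ f (y ⊕ z) *ℤ_) (∑-χ-≢zeros m (z∉ ∘ here))) (ℤ.*-zeroʳ (+ f (y ⊕ z)))

*-cancelˡ-2^ : ∀ m {a b} → + 2 ^ m *ℤ a ≡ + 2 ^ m *ℤ b → a ≡ b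
*-cancelˡ-2^ m {a} {b} = ℤ.*-cancelˡ-≡ (+ 2 ^ m) a b {{ℕ.m^n≢0 2 m}}

-- Decks and products of Fourier coefficients

∑ⁿ : ∀ m i → (Vec (Z2 m) i → ℤ) → ℤ
∑ⁿ m zero    F = F []
∑ⁿ m (suc i) F = ∑[ s ∈ allZ2 m ] ∑ⁿ m i (λ t → F (s ∷ t))

∏ : ∀ {i} → (A → ℤ) → Vec A i → ℤ
∏ F []       = 1ℤ
∏ F (x ∷ xs) = F x *ℤ ∏ F xs

∏₂ : ∀ {i} → (A → B → ℤ) → Vec A i → Vec B i → ℤ
∏₂ H []       []       = 1ℤ
∏₂ H (x ∷ xs) (t ∷ ts) = H x t *ℤ ∏₂ H xs ts

⨁ : ∀ {m i} → Vec (Z2 m) i → Z2 m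
⨁ []       = zeros
⨁ (x ∷ xs) = x ⊕ ⨁ xs

∑ⁿ-cong : ∀ m i {F G : Vec (Z2 m) i → ℤ} → (∀ t → F t ≡ G t) → ∑ⁿ m i F ≡ ∑ⁿ m i G
∑ⁿ-cong m zero    F≗G = F≗G []
∑ⁿ-cong m (suc i) F≗G = ∑-cong (allZ2 m) (λ s → ∑ⁿ-cong m i (F≗G ∘ (s ∷_)))

∑ⁿ-*ˡ : ∀ m i c (F : Vec (Z2 m) i → ℤ) → ∑ⁿ m i (λ t → c *ℤ F t) ≡ c *ℤ ∑ⁿ m i F
∑ⁿ-*ˡ m zero    c F = refl
∑ⁿ-*ˡ m (suc i) c F = trans (∑-cong (allZ2 m) (λ s → ∑ⁿ-*ˡ m i c (F ∘ (s ∷_)))) (∑-*ˡ (allZ2 m) c _)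

∑ⁿ-∑ : ∀ m i (l : List A) (P : A → Vec (Z2 m) i → ℤ) →
       ∑ⁿ m i (λ t → ∑[ g ∈ l ] P g t) ≡ ∑[ g ∈ l ] ∑ⁿ m i (P g)
∑ⁿ-∑ m zero    l P = refl
∑ⁿ-∑ m (suc i) l P = trans (∑-cong (allZ2 m) (λ s → ∑ⁿ-∑ m i l (λ g t → P g (s ∷ t))))
                           (∑-comm (allZ2 m) l (λ s g → ∑ⁿ m i (λ t → P g (s ∷ t))))

∑ⁿ-∏₂ : ∀ m i (H : Z2 m → Z2 m → ℤ) (x : Vec (Z2 m) i) →
        ∑ⁿ m i (∏₂ H x) ≡ ∏ (λ y → ∑ (allZ2 m) (H y)) x
∑ⁿ-∏₂ m zero    H []      = refl
∑ⁿ-∏₂ m (suc i) H (y ∷ x) = begin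
  ∑[ s ∈ allZ2 m ] ∑ⁿ m i (λ t → H y s *ℤ ∏₂ H x t)  ≡⟨ ∑-cong (allZ2 m) (λ s → ∑ⁿ-*ˡ m i (H y s) (∏₂ H x)) ⟩
  ∑[ s ∈ allZ2 m ] H y s *ℤ ∑ⁿ m i (∏₂ H x)          ≡⟨ ∑-*ʳ (allZ2 m) _ (H y) ⟩
  ∑ (allZ2 m) (H y) *ℤ ∑ⁿ m i (∏₂ H x)               ≡⟨ cong (∑ (allZ2 m) (H y) *ℤ_) (∑ⁿ-∏₂ m i H x) ⟩
  ∑ (allZ2 m) (H y) *ℤ ∏ (λ y → ∑ (allZ2 m) (H y)) x ∎

∏-cong : ∀ {i} {F G : A → ℤ} (x : Vec A i) → (∀ y → F y ≡ G y) → ∏ F x ≡ ∏ G x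
∏-cong []      F≗G = refl
∏-cong (y ∷ x) F≗G = cong₂ _*ℤ_ (F≗G y) (∏-cong x F≗G)

∏-* : ∀ {i} (F G : A → ℤ) (x : Vec A i) → ∏ (λ y → F y *ℤ G y) x ≡ ∏ F x *ℤ ∏ G x
∏-* F G []      = refl
∏-* F G (y ∷ x) = trans (cong (F y *ℤ G y *ℤ_) (∏-* F G x)) (interchange (F y) (G y) _ _)
  where
  interchange : ∀ a b c d → (a *ℤ b) *ℤ (c *ℤ d) ≡ (a *ℤ c) *ℤ (b *ℤ d)
  interchange = solve-∀

∏-map : ∀ {i} (F : B → ℤ) (h : A → B) (x : Vec A i) → ∏ F (Vec.map h x) ≡ ∏ (F ∘ h) x
∏-map F h []      = refl
∏-map F h (y ∷ x) = cong (F (h y) *ℤ_) (∏-map F h x)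

∏-∏₂ : ∀ {i} (F : B → ℤ) (G : A → B → ℤ) (x : Vec A i) (t : Vec B i) →
       ∏ F t *ℤ ∏₂ G x t ≡ ∏₂ (λ y s → F s *ℤ G y s) x t
∏-∏₂ F G []      []      = refl
∏-∏₂ F G (y ∷ x) (s ∷ t) = trans (interchange (F s) (∏ F t) (G y s) (∏₂ G x t)) (cong (F s *ℤ G y s *ℤ_) (∏-∏₂ F G x t))
  where
  interchange : ∀ a b c d → (a *ℤ b) *ℤ (c *ℤ d) ≡ (a *ℤ c) *ℤ (b *ℤ d)
  interchange = solve-∀

∏-χ : ∀ {m i} (x : Vec (Z2 m) i) (g : Z2 m) → ∏ (λ y → χ y g) x ≡ χ (⨁ x) g
∏-χ []      g = sym (χ-zerosˡ g)
∏-χ (y ∷ x) g = trans (cong (χ y g *ℤ_) (∏-χ x g)) (sym (χ-⊕ˡ y (⨁ x) g))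

⨁-map-false : ∀ {n i} (v : Vec (Z2 n) i) → ⨁ (Vec.map (false ∷_) v) ≡ false ∷ ⨁ v
⨁-map-false []      = refl
⨁-map-false (y ∷ v) = cong ((false ∷ y) ⊕_) (⨁-map-false v)

prodAt-pos : ∀ {m i} (f : Multiset m) (g : Z2 m) (t : Vec (Z2 m) i) → + prodAt f g t ≡ ∏ (λ s → + f (g ⊕ s)) t
prodAt-pos f g []      = refl
prodAt-pos f g (s ∷ t) = trans (ℤ.pos-* (f (g ⊕ s)) _) (cong (+ f (g ⊕ s) *ℤ_) (prodAt-pos f g t))

∑-deck-χ : ∀ {m i} (f : Multiset m) (x : Vec (Z2 m) i) → ⨁ x ≡ zeros →
           ∑ⁿ m i (λ t → + deck i f t *ℤ ∏₂ χ x t) ≡ + 2 ^ m *ℤ ∏ (fourier f) x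
∑-deck-χ {m} {i} f x ⨁x≡0 = begin
  ∑ⁿ m i (λ t → + deck i f t *ℤ ∏₂ χ x t)           ≡⟨ ∑ⁿ-cong m i expand-deck ⟩
  ∑ⁿ m i (λ t → ∑[ g ∈ U ] ∏₂ (H g) x t)            ≡⟨ ∑ⁿ-∑ m i U (λ g → ∏₂ (H g) x) ⟩
  ∑[ g ∈ U ] ∑ⁿ m i (∏₂ (H g) x)                    ≡⟨ ∑-cong U (λ g → ∑ⁿ-∏₂ m i (H g) x) ⟩
  ∑[ g ∈ U ] ∏ (λ y → ∑ U (H g y)) x                ≡⟨ ∑-cong U (λ g → ∏-cong x (λ y → fourier-shift f y g)) ⟩
  ∑[ g ∈ U ] ∏ (λ y → χ y g *ℤ fourier f y) x       ≡⟨ ∑-cong U factor ⟩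
  ∑[ g ∈ U ] χ (⨁ x) g *ℤ ∏ (fourier f) x           ≡⟨ ∑-*ʳ U _ (χ (⨁ x)) ⟩
  (∑[ g ∈ U ] χ (⨁ x) g) *ℤ ∏ (fourier f) x         ≡⟨ cong (λ v → (∑[ g ∈ U ] χ v g) *ℤ ∏ (fourier f) x) ⨁x≡0 ⟩
  (∑[ g ∈ U ] χ zeros g) *ℤ ∏ (fourier f) x         ≡⟨ cong (_*ℤ ∏ (fourier f) x) (trans (∑-cong U χ-zerosˡ) (∑-allZ2-one m)) ⟩
  + 2 ^ m *ℤ ∏ (fourier f) x                        ∎
  where
  U = allZ2 m
  H : Z2 m → Z2 m → Z2 m → ℤ
  H g y s = + f (g ⊕ s) *ℤ χ y s
  factor : ∀ g → ∏ (λ y → χ y g *ℤ fourier f y) x ≡ χ (⨁ x) g *ℤ ∏ (fourier f) x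
  factor g = trans (∏-* (λ y → χ y g) (fourier f) x) (cong (_*ℤ ∏ (fourier f) x) (∏-χ x g))
  expand-deck : ∀ t → + deck i f t *ℤ ∏₂ χ x t ≡ ∑[ g ∈ U ] ∏₂ (H g) x t
  expand-deck t = begin
    + deck i f t *ℤ ∏₂ χ x t                         ≡⟨ cong (_*ℤ ∏₂ χ x t) (∑-pos U (λ g → prodAt f g t)) ⟩
    (∑[ g ∈ U ] + prodAt f g t) *ℤ ∏₂ χ x t          ≡⟨ sym (∑-*ʳ U _ _) ⟩
    ∑[ g ∈ U ] + prodAt f g t *ℤ ∏₂ χ x t
      ≡⟨ ∑-cong U (λ g → trans (cong (_*ℤ ∏₂ χ x t) (prodAt-pos f g t)) (∏-∏₂ _ χ x t)) ⟩
    ∑[ g ∈ U ] ∏₂ (H g) x t                          ∎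

∏-fourier≡ : ∀ {m i} {f₁ f₂ : Multiset m} → (∀ t → deck i f₁ t ≡ deck i f₂ t) →
             (x : Vec (Z2 m) i) → ⨁ x ≡ zeros → ∏ (fourier f₁) x ≡ ∏ (fourier f₂) x
∏-fourier≡ {m} {i} {f₁} {f₂} decks≡ x ⨁x≡0 = *-cancelˡ-2^ m (begin
  + 2 ^ m *ℤ ∏ (fourier f₁) x                   ≡⟨ sym (∑-deck-χ f₁ x ⨁x≡0) ⟩
  ∑ⁿ m i (λ t → + deck i f₁ t *ℤ ∏₂ χ x t)      ≡⟨ ∑ⁿ-cong m i (λ t → cong (λ d → + d *ℤ ∏₂ χ x t) (decks≡ t)) ⟩
  ∑ⁿ m i (λ t → + deck i f₂ t *ℤ ∏₂ χ x t)      ≡⟨ ∑-deck-χ f₂ x ⨁x≡0 ⟩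
  + 2 ^ m *ℤ ∏ (fourier f₂) x                   ∎)

∏-tabulate-cong : ∀ {n} (F G : A → ℤ) (g : Fin n → A) → (∀ i → F (g i) ≡ G (g i)) → ∏ F (tabulate g) ≡ ∏ G (tabulate g)
∏-tabulate-cong {n = zero}  F G g F≗G = refl
∏-tabulate-cong {n = suc n} F G g F≗G = cong₂ _*ℤ_ (F≗G zero) (∏-tabulate-cong F G (g ∘ suc) (F≗G ∘ suc))

∏-tabulate-zero : ∀ {n} (F : A → ℤ) (g : Fin n → A) i → F (g i) ≡ 0ℤ → ∏ F (tabulate g) ≡ 0ℤ
∏-tabulate-zero F g zero    Fgᵢ≡0 = cong (_*ℤ ∏ F (tabulate (g ∘ suc))) Fgᵢ≡0
∏-tabulate-zero F g (suc i) Fgᵢ≡0 = trans (cong (F (g zero) *ℤ_) (∏-tabulate-zero F (g ∘ suc) i Fgᵢ≡0)) (ℤ.*-zeroʳ (F (g zero)))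

∏-tabulate-basis : ∀ {n} (F : Z2 (suc n) → ℤ) →
                   ∏ F (tabulate basis) ≡ F (basis zero) *ℤ ∏ (F ∘ (false ∷_)) (tabulate basis)
∏-tabulate-basis F =
  cong (F (basis zero) *ℤ_) (trans (cong (∏ F) (Vec.tabulate-∘ (false ∷_) basis)) (∏-map F (false ∷_) (tabulate basis)))

fourierProduct-∏ : ∀ {m} (f : Multiset m) → fourierProduct f ≡ ∏ (fourier f) (tabulate basis) *ℤ fourier f hvec
fourierProduct-∏ f =
  trans (cong (Vec.foldr _ _*ℤ_ (fourier f hvec)) (Vec.tabulate-∘ (fourier f) basis)) (foldr-map (fourier f) (tabulate basis))
  where
  foldr-map : ∀ {i} (F : A → ℤ) (v : Vec A i) → Vec.foldr _ _*ℤ_ (fourier f hvec) (Vec.map F v) ≡ ∏ F v *ℤ fourier f hvec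
  foldr-map F []      = sym (ℤ.*-identityˡ _)
  foldr-map F (y ∷ v) = trans (cong (F y *ℤ_) (foldr-map F v)) (sym (ℤ.*-assoc (F y) _ _))

⨁-tabulate-basis : ∀ {n} → ⨁ (tabulate (basis {n})) ≡ hvec
⨁-tabulate-basis {zero}  = refl
⨁-tabulate-basis {suc n} = begin
  basis zero ⊕ ⨁ (tabulate (basis ∘ suc))                 ≡⟨ cong (λ v → basis zero ⊕ ⨁ v) (Vec.tabulate-∘ (false ∷_) basis) ⟩
  basis zero ⊕ ⨁ (Vec.map (false ∷_) (tabulate basis))    ≡⟨ cong₂ _⊕_ (basis-zero {n}) (⨁-map-false (tabulate basis)) ⟩
  true ∷ (zeros ⊕ ⨁ (tabulate basis))                     ≡⟨ cong (true ∷_) (trans (⊕-identityˡ _) ⨁-tabulate-basis) ⟩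
  hvec                                                    ∎

-- The signs (-1)^{zᵢ} and (-1)^{z₁+⋯+zₘ} introduced at e₁, …, eₘ and h = e₁ + ⋯ + eₘ cancel.
fourierProduct-translate : ∀ {m} (z : Z2 m) (f : Multiset m) → fourierProduct (translate z f) ≡ fourierProduct f
fourierProduct-translate z f = begin
  fourierProduct (translate z f)
    ≡⟨ fourierProduct-∏ (translate z f) ⟩
  ∏ (fourier (translate z f)) (tabulate basis) *ℤ fourier (translate z f) hvec
    ≡⟨ cong₂ _*ℤ_ (trans (∏-cong (tabulate basis) (λ x → fourier-translate z f x)) (∏-* (λ x → χ x z) (fourier f) (tabulate basis)))
                  (fourier-translate z f hvec) ⟩
  (∏ (λ x → χ x z) (tabulate basis) *ℤ P) *ℤ (χ hvec z *ℤ fourier f hvec)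
    ≡⟨ cong (λ s → (s *ℤ P) *ℤ (χ hvec z *ℤ fourier f hvec))
            (trans (∏-χ (tabulate basis) z) (cong (λ v → χ v z) ⨁-tabulate-basis)) ⟩
  (χ hvec z *ℤ P) *ℤ (χ hvec z *ℤ fourier f hvec)
    ≡⟨ rearrange (χ hvec z) P (fourier f hvec) ⟩
  (χ hvec z *ℤ χ hvec z) *ℤ (P *ℤ fourier f hvec)
    ≡⟨ trans (cong (_*ℤ _) (χ-sq hvec z)) (ℤ.*-identityˡ _) ⟩
  P *ℤ fourier f hvec
    ≡⟨ sym (fourierProduct-∏ f) ⟩
  fourierProduct f
    ∎
  where
  P = ∏ (fourier f) (tabulate basis)
  rearrange : ∀ s p h → (s *ℤ p) *ℤ (s *ℤ h) ≡ (s *ℤ s) *ℤ (p *ℤ h)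
  rearrange = solve-∀

weight : ∀ {n} → Z2 n → ℕ
weight []          = 0
weight (true ∷ x)  = suc (weight x)
weight (false ∷ x) = weight x

coweight : ∀ {n} → Z2 n → ℕ
coweight []          = 0
coweight (true ∷ x)  = coweight x
coweight (false ∷ x) = suc (coweight x)

weight+coweight : ∀ {n} (x : Z2 n) → weight x ℕ.+ coweight x ≡ n
weight+coweight []          = refl
weight+coweight (true ∷ x)  = cong suc (weight+coweight x)
weight+coweight (false ∷ x) = trans (ℕ.+-suc (weight x) (coweight x)) (cong suc (weight+coweight x))

weight≤ : ∀ {n} (x : Z2 n) → weight x ≤ n
weight≤ x = subst (weight x ≤_) (weight+coweight x) (ℕ.m≤m+n (weight x) (coweight x))

weight-zeros : ∀ n → weight (zeros {n}) ≡ 0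
weight-zeros zero    = refl
weight-zeros (suc n) = weight-zeros n

weight-hvec : ∀ n → weight (hvec {n}) ≡ n
weight-hvec zero    = refl
weight-hvec (suc n) = cong suc (weight-hvec n)

weight-basis : ∀ {n} (i : Fin n) → weight (basis i) ≡ 1
weight-basis {suc n} zero    = trans (cong weight (basis-zero {n})) (cong suc (weight-zeros n))
weight-basis {suc n} (suc i) = weight-basis i

weight≡0⇒zeros : ∀ {n} (x : Z2 n) → weight x ≡ 0 → x ≡ zeros
weight≡0⇒zeros []          _   = refl
weight≡0⇒zeros (false ∷ x) w≡0 = cong (false ∷_) (weight≡0⇒zeros x w≡0)

weight≡1⇒basis : ∀ {n} (x : Z2 n) → weight x ≡ 1 → ∃[ j ] x ≡ basis j
weight≡1⇒basis {suc n} (true ∷ x) w≡1 = zero , trans (cong (true ∷_) (weight≡0⇒zeros x (ℕ.suc-injective w≡1))) (sym basis-zero)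
weight≡1⇒basis (false ∷ x) w≡1 with weight≡1⇒basis x w≡1
... | j , x≡eⱼ = suc j , cong (false ∷_) x≡eⱼ

weight≡n⇒hvec : ∀ {n} (x : Z2 n) → weight x ≡ n → x ≡ hvec
weight≡n⇒hvec []          _   = refl
weight≡n⇒hvec (true ∷ x)  w≡n = cong (true ∷_) (weight≡n⇒hvec x (ℕ.suc-injective w≡n))
weight≡n⇒hvec (false ∷ x) w≡n = contradiction (subst (_≤ _) w≡n (weight≤ x)) (ℕ.<-irrefl refl)

parity-zeros : ∀ n → parity (zeros {n}) ≡ false
parity-zeros zero    = refl
parity-zeros (suc n) = parity-zeros n

parity-basis : ∀ {n} (j : Fin n) → parity (basis j) ≡ true
parity-basis {suc n} zero    = trans (cong parity (basis-zero {n})) (cong (true xor_) (parity-zeros n))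
parity-basis         (suc j) = parity-basis j

supportBasis : ∀ {n} (x : Z2 n) → Vec (Z2 n) (weight x)
supportBasis []          = []
supportBasis (true ∷ x)  = basis zero ∷ Vec.map (false ∷_) (supportBasis x)
supportBasis (false ∷ x) = Vec.map (false ∷_) (supportBasis x)

coSupportBasis : ∀ {n} (x : Z2 n) → Vec (Z2 n) (coweight x)
coSupportBasis []          = []
coSupportBasis (true ∷ x)  = Vec.map (false ∷_) (coSupportBasis x)
coSupportBasis (false ∷ x) = basis zero ∷ Vec.map (false ∷_) (coSupportBasis x)

⨁-supportBasis : ∀ {n} (x : Z2 n) → ⨁ (supportBasis x) ≡ x
⨁-supportBasis []          = refl
⨁-supportBasis (true ∷ x)  = begin
  basis zero ⊕ ⨁ (Vec.map (false ∷_) (supportBasis x))  ≡⟨ cong₂ _⊕_ basis-zero (⨁-map-false (supportBasis x)) ⟩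
  true ∷ (zeros ⊕ ⨁ (supportBasis x))                   ≡⟨ cong (true ∷_) (trans (⊕-identityˡ _) (⨁-supportBasis x)) ⟩
  true ∷ x                                              ∎
⨁-supportBasis (false ∷ x) = trans (⨁-map-false (supportBasis x)) (cong (false ∷_) (⨁-supportBasis x))

⨁-coSupportBasis : ∀ {n} (x : Z2 n) → ⨁ (coSupportBasis x) ≡ hvec ⊕ x
⨁-coSupportBasis []          = refl
⨁-coSupportBasis (true ∷ x)  = trans (⨁-map-false (coSupportBasis x)) (cong (false ∷_) (⨁-coSupportBasis x))
⨁-coSupportBasis (false ∷ x) = begin
  basis zero ⊕ ⨁ (Vec.map (false ∷_) (coSupportBasis x))  ≡⟨ cong₂ _⊕_ basis-zero (⨁-map-false (coSupportBasis x)) ⟩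
  true ∷ (zeros ⊕ ⨁ (coSupportBasis x))                   ≡⟨ cong (true ∷_) (trans (⊕-identityˡ _) (⨁-coSupportBasis x)) ⟩
  true ∷ (hvec ⊕ x)                                       ∎

∏-supportBasis : ∀ {n} (F : Z2 n → ℤ) (x : Z2 n) →
                 ∏ F (supportBasis x) *ℤ ∏ F (coSupportBasis x) ≡ ∏ F (tabulate basis)
∏-supportBasis F []          = refl
∏-supportBasis F (true ∷ x)  = begin
  F (basis zero) *ℤ ∏ F (Vec.map (false ∷_) (supportBasis x)) *ℤ ∏ F (Vec.map (false ∷_) (coSupportBasis x))
    ≡⟨ cong₂ (λ p q → F (basis zero) *ℤ p *ℤ q) (∏-map F _ (supportBasis x)) (∏-map F _ (coSupportBasis x)) ⟩
  F (basis zero) *ℤ ∏ G (supportBasis x) *ℤ ∏ G (coSupportBasis x)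
    ≡⟨ trans (ℤ.*-assoc (F (basis zero)) _ _) (cong (F (basis zero) *ℤ_) (∏-supportBasis G x)) ⟩
  F (basis zero) *ℤ ∏ G (tabulate basis)
    ≡⟨ sym (∏-tabulate-basis F) ⟩
  ∏ F (tabulate basis)
    ∎
  where G = F ∘ (false ∷_)
∏-supportBasis F (false ∷ x) = begin
  ∏ F (Vec.map (false ∷_) (supportBasis x)) *ℤ (F (basis zero) *ℤ ∏ F (Vec.map (false ∷_) (coSupportBasis x)))
    ≡⟨ cong₂ (λ p q → p *ℤ (F (basis zero) *ℤ q)) (∏-map F _ (supportBasis x)) (∏-map F _ (coSupportBasis x)) ⟩
  ∏ G (supportBasis x) *ℤ (F (basis zero) *ℤ ∏ G (coSupportBasis x))
    ≡⟨ trans (rearrange (F (basis zero)) (∏ G (supportBasis x)) (∏ G (coSupportBasis x)))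
             (cong (F (basis zero) *ℤ_) (∏-supportBasis G x)) ⟩
  F (basis zero) *ℤ ∏ G (tabulate basis)
    ≡⟨ sym (∏-tabulate-basis F) ⟩
  ∏ F (tabulate basis)
    ∎
  where
  G = F ∘ (false ∷_)
  rearrange : ∀ a p q → p *ℤ (a *ℤ q) ≡ a *ℤ (p *ℤ q)
  rearrange = solve-∀

∏-special-tuples : ∀ {n} (F : Z2 n → ℤ) (x : Z2 n) →
                   ∏ F (x ∷ supportBasis x) *ℤ ∏ F (x ∷ hvec ∷ coSupportBasis x)
                   ≡ (F x *ℤ F x) *ℤ (∏ F (tabulate basis) *ℤ F hvec)
∏-special-tuples F x =
  trans (rearrange (F x) (∏ F (supportBasis x)) (F hvec) (∏ F (coSupportBasis x)))
        (cong (λ p → (F x *ℤ F x) *ℤ (p *ℤ F hvec)) (∏-supportBasis F x))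
  where
  rearrange : ∀ a p h q → (a *ℤ p) *ℤ (a *ℤ (h *ℤ q)) ≡ (a *ℤ a) *ℤ ((p *ℤ q) *ℤ h)
  rearrange = solve-∀

specialPoints : ∀ m → List (Z2 m)
specialPoints m = zeros ∷ hvec ∷ List.tabulate basis

specialPoints-unique : ∀ n → Unique (specialPoints (suc (suc n)))
specialPoints-unique n =
  (zeros≢hvec ListAll.∷ ListAll.tabulate⁺ zeros≢basis) ∷ ListAll.tabulate⁺ hvec≢basis ∷ Unique.tabulate⁺ basis-injective
  where
  m = suc (suc n)
  zeros≢hvec : zeros ≢ hvec
  zeros≢hvec 0≡h with trans (sym (weight-zeros m)) (trans (cong weight 0≡h) (weight-hvec m))
  ... | ()
  zeros≢basis : ∀ i → zeros ≢ basis i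
  zeros≢basis i 0≡eᵢ with trans (sym (weight-zeros m)) (trans (cong weight 0≡eᵢ) (weight-basis i))
  ... | ()
  hvec≢basis : ∀ i → hvec ≢ basis i
  hvec≢basis i h≡eᵢ with trans (sym (weight-hvec m)) (trans (cong weight h≡eᵢ) (weight-basis i))
  ... | ()

∉specialPoints⇒ : ∀ {m} (x : Z2 m) → x ∉ specialPoints m → 2 ≤ weight x × weight x < m
∉specialPoints⇒ {m} x x∉ with weight x in w≡
... | 0           = contradiction (here (weight≡0⇒zeros x w≡)) x∉
... | 1           with weight≡1⇒basis x w≡
...   | j , refl  = contradiction (there (there (∈-tabulate⁺ j))) x∉
∉specialPoints⇒ {m} x x∉ | suc (suc w) =
  s≤s (s≤s z≤n) ,
  ℕ.≤∧≢⇒< (subst (_≤ m) w≡ (weight≤ x)) (λ w≡m → x∉ (there (here (weight≡n⇒hvec x (trans w≡ w≡m)))))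

-- Fourier coefficients of indistinguishable multisets

indistinguishable-below : ∀ {m k} {f₁ f₂ : Multiset m} → DistinguishingNumber f₁ f₂ (suc k) → Indistinguishable k f₁ f₂
indistinguishable-below {k = k} {f₁} {f₂} (_ , minimal) i i≤k t =
  decidable-stable (deck i f₁ t ℕ.≟ deck i f₂ t) (λ decks≢ → minimal k ℕ.≤-refl (λ I → decks≢ (I i i≤k t)))

indistinguishable-sym : ∀ {m k} {f₁ f₂ : Multiset m} → Indistinguishable k f₁ f₂ → Indistinguishable k f₂ f₁
indistinguishable-sym I i i≤k t = sym (I i i≤k t)

sq≡0 : ∀ a → a *ℤ a ≡ 0ℤ → a ≡ 0ℤ
sq≡0 a a²≡0 with ℤ.i*j≡0⇒i≡0∨j≡0 a a²≡0
... | inj₁ a≡0 = a≡0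
... | inj₂ a≡0 = a≡0

sq≡⇒≡∨≡- : ∀ a b → a *ℤ a ≡ b *ℤ b → a ≡ b ⊎ b ≡ - a
sq≡⇒≡∨≡- a b a²≡b² with ℤ.i*j≡0⇒i≡0∨j≡0 (a -ℤ b) product≡0
  where
  factorise : ∀ a b → (a -ℤ b) *ℤ (a +ℤ b) ≡ a *ℤ a -ℤ b *ℤ b
  factorise = solve-∀
  product≡0 : (a -ℤ b) *ℤ (a +ℤ b) ≡ 0ℤ
  product≡0 = trans (factorise a b) (trans (cong (_-ℤ b *ℤ b) a²≡b²) (ℤ.+-inverseʳ (b *ℤ b)))
... | inj₁ a-b≡0 = inj₁ (ℤ.i-j≡0⇒i≡j a b a-b≡0)
... | inj₂ a+b≡0 = inj₂ (trans (rearrange a b) (trans (cong (_-ℤ a) a+b≡0) (ℤ.+-identityˡ (- a))))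
  where
  rearrange : ∀ a b → b ≡ (a +ℤ b) -ℤ a
  rearrange = solve-∀

sq≡∧≢⇒≡- : ∀ a b → a *ℤ a ≡ b *ℤ b → a ≢ b → b ≡ - a
sq≡∧≢⇒≡- a b a²≡b² a≢b with sq≡⇒≡∨≡- a b a²≡b²
... | inj₁ a≡b  = contradiction a≡b a≢b
... | inj₂ b≡-a = b≡-a

sq≡⇒∣∣≡ : ∀ a b → a *ℤ a ≡ b *ℤ b → ∣ a ∣ ≡ ∣ b ∣
sq≡⇒∣∣≡ a b a²≡b² with sq≡⇒≡∨≡- a b a²≡b²
... | inj₁ refl = refl
... | inj₂ refl = sym (ℤ.∣-i∣≡∣i∣ a)

module _ {m} {f₁ f₂ : Multiset m} (I : Indistinguishable m f₁ f₂) where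

  fourier-zeros≡ : 1 ≤ m → fourier f₁ zeros ≡ fourier f₂ zeros
  fourier-zeros≡ 1≤m = begin
    fourier f₁ zeros           ≡⟨ sym (ℤ.*-identityʳ _) ⟩
    ∏ (fourier f₁) (zeros ∷ [])  ≡⟨ ∏-fourier≡ (I 1 1≤m) (zeros ∷ []) (⊕-self zeros) ⟩
    ∏ (fourier f₂) (zeros ∷ [])  ≡⟨ ℤ.*-identityʳ _ ⟩
    fourier f₂ zeros           ∎

  fourier²≡ : 2 ≤ m → ∀ x → fourier f₁ x *ℤ fourier f₁ x ≡ fourier f₂ x *ℤ fourier f₂ x
  fourier²≡ 2≤m x = begin
    fourier f₁ x *ℤ fourier f₁ x     ≡⟨ cong (fourier f₁ x *ℤ_) (sym (ℤ.*-identityʳ _)) ⟩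
    ∏ (fourier f₁) (x ∷ x ∷ [])      ≡⟨ ∏-fourier≡ (I 2 2≤m) (x ∷ x ∷ []) (⊕-cancelˡ x zeros) ⟩
    ∏ (fourier f₂) (x ∷ x ∷ [])      ≡⟨ cong (fourier f₂ x *ℤ_) (ℤ.*-identityʳ _) ⟩
    fourier f₂ x *ℤ fourier f₂ x     ∎

  -- The two zero-sum tuples x e_{i₁} ⋯ e_{i_w} and x h e_{j₁} ⋯ e_{j_{m-w}} (the i's running over the
  -- support of x, the j's over its complement) both have length at most m exactly when 2 ≤ w < m.
  fourier²*fourierProduct≡ : ∀ x → 2 ≤ weight x → weight x < m →
    (fourier f₁ x *ℤ fourier f₁ x) *ℤ fourierProduct f₁ ≡ (fourier f₂ x *ℤ fourier f₂ x) *ℤ fourierProduct f₂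
  fourier²*fourierProduct≡ x 2≤w w<m = begin
    (F₁ x *ℤ F₁ x) *ℤ fourierProduct f₁                          ≡⟨ cong ((F₁ x *ℤ F₁ x) *ℤ_) (fourierProduct-∏ f₁) ⟩
    (F₁ x *ℤ F₁ x) *ℤ (∏ F₁ (tabulate basis) *ℤ F₁ hvec)         ≡⟨ sym (∏-special-tuples F₁ x) ⟩
    ∏ F₁ (x ∷ supportBasis x) *ℤ ∏ F₁ (x ∷ hvec ∷ coSupportBasis x)  ≡⟨ cong₂ _*ℤ_ support≡ coSupport≡ ⟩
    ∏ F₂ (x ∷ supportBasis x) *ℤ ∏ F₂ (x ∷ hvec ∷ coSupportBasis x)  ≡⟨ ∏-special-tuples F₂ x ⟩
    (F₂ x *ℤ F₂ x) *ℤ (∏ F₂ (tabulate basis) *ℤ F₂ hvec)         ≡⟨ cong ((F₂ x *ℤ F₂ x) *ℤ_) (sym (fourierProduct-∏ f₂)) ⟩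
    (F₂ x *ℤ F₂ x) *ℤ fourierProduct f₂                          ∎
    where
    F₁ = fourier f₁
    F₂ = fourier f₂
    coSupport-length : 2 ℕ.+ coweight x ≤ m
    coSupport-length = subst (2 ℕ.+ coweight x ≤_) (weight+coweight x) (ℕ.+-monoˡ-≤ (coweight x) 2≤w)
    support≡ : ∏ F₁ (x ∷ supportBasis x) ≡ ∏ F₂ (x ∷ supportBasis x)
    support≡ = ∏-fourier≡ (I _ w<m) (x ∷ supportBasis x) (trans (cong (x ⊕_) (⨁-supportBasis x)) (⊕-self x))
    coSupport≡ : ∏ F₁ (x ∷ hvec ∷ coSupportBasis x) ≡ ∏ F₂ (x ∷ hvec ∷ coSupportBasis x)
    coSupport≡ = ∏-fourier≡ (I _ coSupport-length) (x ∷ hvec ∷ coSupportBasis x)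
                   (trans (cong (λ v → x ⊕ (hvec ⊕ v)) (⨁-coSupportBasis x)) (trans (cong (x ⊕_) (⊕-cancelˡ hvec x)) (⊕-self x)))

  module _ (fp≢ : fourierProduct f₁ ≢ fourierProduct f₂) where

    fourier-vanishes : ∀ x → 2 ≤ weight x → weight x < m → fourier f₁ x ≡ 0ℤ
    fourier-vanishes x 2≤w w<m with fourier f₁ x ℤ.≟ 0ℤ
    ... | yes F₁x≡0 = F₁x≡0
    ... | no  F₁x≢0 = contradiction fp≡ fp≢
      where
      2≤m : 2 ≤ m
      2≤m = ℕ.≤-trans 2≤w (ℕ.<⇒≤ w<m)
      fp≡ : fourierProduct f₁ ≡ fourierProduct f₂
      fp≡ = ℤ.*-cancelˡ-≡ (fourier f₁ x *ℤ fourier f₁ x) (fourierProduct f₁) (fourierProduct f₂)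
              {{ℤ.≢-nonZero (F₁x≢0 ∘ sq≡0 (fourier f₁ x))}}
              (trans (fourier²*fourierProduct≡ x 2≤w w<m) (cong (_*ℤ fourierProduct f₂) (sym (fourier²≡ 2≤m x))))

    fourier-basis≢0 : 2 ≤ m → ∀ i → fourier f₁ (basis i) ≢ 0ℤ
    fourier-basis≢0 2≤m i F₁eᵢ≡0 = fp≢ (begin
      fourierProduct f₁
        ≡⟨ fourierProduct-∏ f₁ ⟩
      ∏ (fourier f₁) (tabulate basis) *ℤ fourier f₁ hvec
        ≡⟨ cong (_*ℤ fourier f₁ hvec) (∏-tabulate-zero (fourier f₁) basis i F₁eᵢ≡0) ⟩
      0ℤ
        ≡⟨ sym (cong (_*ℤ fourier f₂ hvec) (∏-tabulate-zero (fourier f₂) basis i F₂eᵢ≡0)) ⟩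
      ∏ (fourier f₂) (tabulate basis) *ℤ fourier f₂ hvec
        ≡⟨ sym (fourierProduct-∏ f₂) ⟩
      fourierProduct f₂
        ∎)
      where
      F₂eᵢ≡0 : fourier f₂ (basis i) ≡ 0ℤ
      F₂eᵢ≡0 = sq≡0 (fourier f₂ (basis i)) (trans (sym (fourier²≡ 2≤m (basis i))) (cong (λ v → v *ℤ v) F₁eᵢ≡0))

-- Sparse Fourier inversion

∑-supported-specialPoints : ∀ n (F : Z2 (suc (suc n)) → ℤ) → (∀ x → x ∉ specialPoints _ → F x ≡ 0ℤ) →
  ∑ (allZ2 (suc (suc n))) F ≡ F zeros +ℤ (F hvec +ℤ (∑[ i ∈ allFin (suc (suc n)) ] F (basis i)))
∑-supported-specialPoints n F F-vanishes = begin
  ∑ (allZ2 (suc (suc n))) F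
    ≡⟨ Indicator.∑-supported _≟ᶻ_ _ _ F (allZ2-unique _) ∈-allZ2 (specialPoints-unique n) F-vanishes ⟩
  F zeros +ℤ (F hvec +ℤ ∑ (List.tabulate basis) F)
    ≡⟨ cong (λ s → F zeros +ℤ (F hvec +ℤ s)) (∑-tabulate basis F) ⟩
  F zeros +ℤ (F hvec +ℤ (∑[ i ∈ allFin _ ] F (basis i)))
    ∎

spectral : ∀ {m} → ℤ → ℤ → (Fin m → ℤ) → Z2 m → ℤ
spectral S H c y = S +ℤ H *ℤ χ hvec y +ℤ (∑[ i ∈ allFin _ ] c i *ℤ χ (basis i) y)

sparse-fourier-inversion : ∀ {n} (g : Multiset (suc (suc n))) {S H : ℤ} {c : Fin (suc (suc n)) → ℤ} →
  (∀ x → x ∉ specialPoints _ → fourier g x ≡ 0ℤ) →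
  fourier g zeros ≡ S → fourier g hvec ≡ H → (∀ i → fourier g (basis i) ≡ c i) →
  ∀ y → + 2 ^ suc (suc n) *ℤ + g y ≡ spectral S H c y
sparse-fourier-inversion {n} g {S} {H} {c} ĝ-vanishes ĝ₀≡S ĝₕ≡H ĝₑ≡c y = begin
  + 2 ^ m *ℤ + g y
    ≡⟨ sym (fourier-inversion g y) ⟩
  ∑[ x ∈ allZ2 m ] ĝ x *ℤ χ x y
    ≡⟨ ∑-supported-specialPoints n (λ x → ĝ x *ℤ χ x y) vanishes ⟩
  ĝ zeros *ℤ χ zeros y +ℤ (ĝ hvec *ℤ χ hvec y +ℤ (∑[ i ∈ allFin m ] ĝ (basis i) *ℤ χ (basis i) y))
    ≡⟨ cong₃ (trans (cong₂ _*ℤ_ ĝ₀≡S (χ-zerosˡ y)) (ℤ.*-identityʳ S))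
             (cong (_*ℤ χ hvec y) ĝₕ≡H)
             (∑-cong (allFin m) (λ i → cong (_*ℤ χ (basis i) y) (ĝₑ≡c i))) ⟩
  S +ℤ (H *ℤ χ hvec y +ℤ (∑[ i ∈ allFin m ] c i *ℤ χ (basis i) y))
    ≡⟨ sym (ℤ.+-assoc S _ _) ⟩
  spectral S H c y
    ∎
  where
  m = suc (suc n)
  ĝ = fourier g
  cong₃ : ∀ {a a′ b b′ c c′} → a ≡ a′ → b ≡ b′ → c ≡ c′ → a +ℤ (b +ℤ c) ≡ a′ +ℤ (b′ +ℤ c′)
  cong₃ refl refl refl = refl
  vanishes : ∀ x → x ∉ specialPoints m → ĝ x *ℤ χ x y ≡ 0ℤ
  vanishes x x∉ = cong (_*ℤ χ x y) (ĝ-vanishes x x∉)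

-- Reading off the shape

linear : ∀ {m} → (Fin m → ℤ) → Z2 m → ℤ
linear d y = ∑[ i ∈ allFin _ ] d i *ℤ + bitNat (lookup y i)

sign-as-bit : ∀ (c : ℤ) b → c *ℤ sign b ≡ c +ℤ (- (+ 2) *ℤ c) *ℤ + bitNat b
sign-as-bit c false = identity c
  where
  identity : ∀ c → c *ℤ 1ℤ ≡ c +ℤ (- (+ 2) *ℤ c) *ℤ 0ℤ
  identity = solve-∀
sign-as-bit c true  = identity c
  where
  identity : ∀ c → c *ℤ - 1ℤ ≡ c +ℤ (- (+ 2) *ℤ c) *ℤ 1ℤ
  identity = solve-∀

spectral-split : ∀ {m} (S H : ℤ) (c : Fin m → ℤ) (y : Z2 m) →
  spectral S H c y ≡ (S +ℤ H *ℤ sign (parity y) +ℤ ∑ (allFin m) c) +ℤ linear (λ i → - (+ 2) *ℤ c i) y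
spectral-split {m} S H c y = begin
  S +ℤ H *ℤ χ hvec y +ℤ (∑[ i ∈ allFin m ] c i *ℤ χ (basis i) y)
    ≡⟨ cong₂ (λ h s → S +ℤ H *ℤ sign h +ℤ s) (dot-hvec y)
             (∑-cong (allFin m) (λ i → trans (cong (λ v → c i *ℤ sign v) (dot-basis i y)) (sign-as-bit (c i) (lookup y i)))) ⟩
  S +ℤ H *ℤ sign (parity y) +ℤ (∑[ i ∈ allFin m ] (c i +ℤ (- (+ 2) *ℤ c i) *ℤ + bitNat (lookup y i)))
    ≡⟨ cong (S +ℤ H *ℤ sign (parity y) +ℤ_) (∑-+ (allFin m) c _) ⟩
  S +ℤ H *ℤ sign (parity y) +ℤ (∑ (allFin m) c +ℤ linear (λ i → - (+ 2) *ℤ c i) y)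
    ≡⟨ sym (ℤ.+-assoc (S +ℤ H *ℤ sign (parity y)) _ _) ⟩
  (S +ℤ H *ℤ sign (parity y) +ℤ ∑ (allFin m) c) +ℤ linear (λ i → - (+ 2) *ℤ c i) y
    ∎

linear-zeros : ∀ {m} (d : Fin m → ℤ) → linear d zeros ≡ 0ℤ
linear-zeros {m} d = trans (∑-cong (allFin m) (λ i → trans (cong (λ v → d i *ℤ + bitNat v) (Vec.lookup-replicate i false))
                                                           (ℤ.*-zeroʳ (d i))))
                           (∑-zero (allFin m))

linear-basis : ∀ {m} (d : Fin m → ℤ) (j : Fin m) → linear d (basis j) ≡ d j
linear-basis {m} d j = begin
  ∑[ i ∈ allFin m ] d i *ℤ + bitNat (lookup (basis j) i)  ≡⟨ ∑-cong (allFin m) (λ i → trans (ℤ.*-comm (d i) _) (cong (_*ℤ d i) (bit≡δ i))) ⟩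
  ∑[ i ∈ allFin m ] δ j i *ℤ d i                          ≡⟨ ∑-δ-∈ d (Unique.allFin⁺ m) (∈-tabulate⁺ j) ⟩
  d j                                                     ∎
  where
  open Indicator Fin._≟_ using (δ; ∑-δ-∈)
  bit≡if : ∀ b → + bitNat b ≡ (if b then 1ℤ else 0ℤ)
  bit≡if false = refl
  bit≡if true  = refl
  bit≡δ : ∀ i → + bitNat (lookup (basis j) i) ≡ δ j i
  bit≡δ i = trans (cong (+_ ∘ bitNat) (Vec.lookup∘tabulate _ i)) (bit≡if (does (j Fin.≟ i)))

linear-*ˡ : ∀ {m} (a : ℤ) (d : Fin m → ℤ) (y : Z2 m) → linear (λ i → a *ℤ d i) y ≡ a *ℤ linear d y
linear-*ˡ {m} a d y = trans (∑-cong (allFin m) (λ i → ℤ.*-assoc a (d i) _)) (∑-*ˡ (allFin m) a _)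

weighted≡linear : ∀ {m} (α : Fin m → ℕ) (y : Z2 m) → + weighted (tabulate α) y ≡ linear (λ i → + α i) y
weighted≡linear {zero}  α []      = refl
weighted≡linear {suc m} α (b ∷ y) =
  trans (ℤ.pos-+ (α zero ℕ.* bitNat b) _)
        (cong₂ _+ℤ_ (ℤ.pos-* (α zero) (bitNat b))
                    (trans (weighted≡linear (α ∘ suc) y) (sym (∑-tabulate suc (λ i → + α i *ℤ + bitNat (lookup (b ∷ y) i))))))

module _ {m} (N : ℕ) .{{_ : ℕ.NonZero N}} (S H : ℤ) (γ : Fin m → ℕ) (g₁ g₂ : Multiset m)
         (H≢0 : H ≢ 0ℤ) (γ>0 : ∀ i → 0 < γ i)
         (spectrum₁ : ∀ y → + N *ℤ + g₁ y ≡ spectral S H (λ i → - + γ i) y)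
         (spectrum₂ : ∀ y → + N *ℤ + g₂ y ≡ spectral S (- H) (λ i → - + γ i) y) where

  private
    C : ℤ
    C = ∑[ i ∈ allFin m ] - + γ i

    level : ℤ → Bool → ℤ
    level K p = S +ℤ K *ℤ sign p +ℤ C

    coefficients : Fin m → ℤ
    coefficients i = - (+ 2) *ℤ - + γ i

    L : Z2 m → ℤ
    L = linear coefficients

    twice : ∀ x → - (+ 2) *ℤ - x ≡ + 2 *ℤ x
    twice = solve-∀

    split : (g : Multiset m) (K : ℤ) → (∀ y → + N *ℤ + g y ≡ spectral S K (λ i → - + γ i) y) →
            ∀ y → + N *ℤ + g y ≡ level K (parity y) +ℤ L y
    split g K spectrum y = trans (spectrum y) (spectral-split S K _ y)

    at-zeros : (g : Multiset m) (K : ℤ) → (∀ y → + N *ℤ + g y ≡ spectral S K (λ i → - + γ i) y) →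
               + N *ℤ + g zeros ≡ level K false
    at-zeros g K spectrum = begin
      + N *ℤ + g zeros                       ≡⟨ split g K spectrum zeros ⟩
      level K (parity (zeros {m})) +ℤ L zeros  ≡⟨ cong₂ (λ p l → level K p +ℤ l) (parity-zeros m) (linear-zeros coefficients) ⟩
      level K false +ℤ 0ℤ                    ≡⟨ ℤ.+-identityʳ _ ⟩
      level K false                          ∎

    level-neg : ∀ K p → level (- K) p ≡ level K (not p)
    level-neg K false = identity S K C
      where
      identity : ∀ S K C → S +ℤ (- K) *ℤ 1ℤ +ℤ C ≡ S +ℤ K *ℤ - 1ℤ +ℤ C
      identity = solve-∀
    level-neg K true  = identity S K C
      where
      identity : ∀ S K C → S +ℤ (- K) *ℤ - 1ℤ +ℤ C ≡ S +ℤ K *ℤ 1ℤ +ℤ C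
      identity = solve-∀

    a b : ℕ
    a = g₁ zeros
    b = g₂ zeros

    -- e_j has odd parity, so g₁ sits there at the level that g₂ attains at 0, plus 2γ_j.
    g₁-basis : ∀ j → N ℕ.* g₁ (basis j) ≡ N ℕ.* b ℕ.+ 2 ℕ.* γ j
    g₁-basis j = ℤ.+-injective (begin
      + (N ℕ.* g₁ (basis j))                 ≡⟨ ℤ.pos-* N _ ⟩
      + N *ℤ + g₁ (basis j)                  ≡⟨ split g₁ H spectrum₁ (basis j) ⟩
      level H (parity (basis j)) +ℤ L (basis j)  ≡⟨ cong₂ (λ p l → level H p +ℤ l) (parity-basis j) (linear-basis coefficients j) ⟩
      level H true +ℤ - (+ 2) *ℤ - + γ j     ≡⟨ cong₂ _+ℤ_ (sym (trans (at-zeros g₂ (- H) spectrum₂) (level-neg H false)))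
                                                              (twice (+ γ j)) ⟩
      + N *ℤ + b +ℤ + 2 *ℤ + γ j             ≡⟨ sym (cong₂ _+ℤ_ (ℤ.pos-* N b) (ℤ.pos-* 2 (γ j))) ⟩
      + (N ℕ.* b) +ℤ + (2 ℕ.* γ j)           ≡⟨ sym (ℤ.pos-+ (N ℕ.* b) _) ⟩
      + (N ℕ.* b ℕ.+ 2 ℕ.* γ j)              ∎)

    α : Fin m → ℕ
    α j = g₁ (basis j) ∸ b

    N*α : ∀ j → N ℕ.* α j ≡ 2 ℕ.* γ j
    N*α j = begin
      N ℕ.* (g₁ (basis j) ∸ b)            ≡⟨ ℕ.*-distribˡ-∸ N (g₁ (basis j)) b ⟩
      N ℕ.* g₁ (basis j) ∸ N ℕ.* b        ≡⟨ cong (_∸ N ℕ.* b) (g₁-basis j) ⟩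
      N ℕ.* b ℕ.+ 2 ℕ.* γ j ∸ N ℕ.* b     ≡⟨ ℕ.m+n∸m≡n (N ℕ.* b) _ ⟩
      2 ℕ.* γ j                           ∎

    N*weighted : ∀ y → + N *ℤ + weighted (tabulate α) y ≡ L y
    N*weighted y = begin
      + N *ℤ + weighted (tabulate α) y         ≡⟨ cong (+ N *ℤ_) (weighted≡linear α y) ⟩
      + N *ℤ linear (λ i → + α i) y            ≡⟨ sym (linear-*ˡ (+ N) _ y) ⟩
      linear (λ i → + N *ℤ + α i) y            ≡⟨ ∑-cong (allFin m) (λ i → cong (_*ℤ + bitNat (lookup y i)) (coefficient i)) ⟩
      L y                                      ∎
      where
      coefficient : ∀ i → + N *ℤ + α i ≡ coefficients i
      coefficient i = trans (sym (ℤ.pos-* N (α i))) (trans (cong +_ (N*α i)) (trans (ℤ.pos-* 2 (γ i)) (sym (twice (+ γ i)))))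

    α>0 : ∀ j → 0 < α j
    α>0 j = ℕ.n≢0⇒n>0 (λ αⱼ≡0 → ℕ.<-irrefl (trans (sym (ℕ.*-zeroʳ N)) (trans (cong (N ℕ.*_) (sym αⱼ≡0)) (N*α j)))
                                            (ℕ.*-monoʳ-< 2 (γ>0 j)))

    N*level₁ : ∀ p → + N *ℤ + (if p then b else a) ≡ level H p
    N*level₁ false = at-zeros g₁ H spectrum₁
    N*level₁ true  = trans (at-zeros g₂ (- H) spectrum₂) (level-neg H false)

    N*level₂ : ∀ p → + N *ℤ + (if p then a else b) ≡ level (- H) p
    N*level₂ false = at-zeros g₂ (- H) spectrum₂
    N*level₂ true  = trans (at-zeros g₁ H spectrum₁) (sym (level-neg H true))

    shape : (g : Multiset m) (H′ : ℤ) (a′ b′ : ℕ) → (∀ p → + N *ℤ + (if p then b′ else a′) ≡ level H′ p) →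
            (∀ y → + N *ℤ + g y ≡ spectral S H′ (λ i → - + γ i) y) → ∀ y → g y ≡ fShape a′ b′ (tabulate α) y
    shape g H′ a′ b′ N*level spectrum y = ℤ.+-injective (ℤ.*-cancelˡ-≡ (+ N) _ _ (begin
      + N *ℤ + g y
        ≡⟨ split g H′ spectrum y ⟩
      level H′ (parity y) +ℤ L y
        ≡⟨ sym (cong₂ _+ℤ_ (N*level (parity y)) (N*weighted y)) ⟩
      + N *ℤ + (if parity y then b′ else a′) +ℤ + N *ℤ + weighted (tabulate α) y
        ≡⟨ sym (ℤ.*-distribˡ-+ (+ N) _ _) ⟩
      + N *ℤ (+ (if parity y then b′ else a′) +ℤ + weighted (tabulate α) y)
        ≡⟨ cong (+ N *ℤ_) (sym (ℤ.pos-+ (if parity y then b′ else a′) (weighted (tabulate α) y))) ⟩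
      + N *ℤ + fShape a′ b′ (tabulate α) y
        ∎))

    a≢b : a ≢ b
    a≢b a≡b = H≢0 (case ℤ.i*j≡0⇒i≡0∨j≡0 (+ 2) 2H≡0 of λ where
      (inj₁ ())
      (inj₂ H≡0) → H≡0)
      where
      difference : ∀ S K C → (S +ℤ K *ℤ 1ℤ +ℤ C) -ℤ (S +ℤ (- K) *ℤ 1ℤ +ℤ C) ≡ + 2 *ℤ K
      difference = solve-∀
      2H≡0 : + 2 *ℤ H ≡ 0ℤ
      2H≡0 = begin
        + 2 *ℤ H
          ≡⟨ sym (difference S H C) ⟩
        level H false -ℤ level (- H) false
          ≡⟨ cong (_-ℤ level (- H) false) (trans (sym (at-zeros g₁ H spectrum₁)) (cong (λ v → + N *ℤ + v) a≡b)) ⟩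
        + N *ℤ + b -ℤ level (- H) false
          ≡⟨ cong (_-ℤ level (- H) false) (at-zeros g₂ (- H) spectrum₂) ⟩
        level (- H) false -ℤ level (- H) false
          ≡⟨ ℤ.+-inverseʳ (level (- H) false) ⟩
        0ℤ
          ∎

  fShape-from-spectral : ∃[ a ] ∃[ b ] ∃[ as ]
    (a ≢ b × All (λ aᵢ → 0 < aᵢ) as × (∀ y → g₁ y ≡ fShape a b as y) × (∀ y → g₂ y ≡ fShape b a as y))
  fShape-from-spectral =
    a , b , tabulate α , a≢b , AllVec.tabulate⁺ α>0 ,
    shape g₁ H a b N*level₁ spectrum₁ , shape g₂ (- H) b a N*level₂ spectrum₂

-- Standard position

isPositive : ℤ → Bool
isPositive (+ suc _) = true
isPositive _         = false

sign-isPositive : ∀ v → sign (isPositive v) *ℤ v ≡ - + ∣ v ∣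
sign-isPositive (+ zero)  = refl
sign-isPositive (+ suc k) = cong -[1+_] (ℕ.+-identityʳ k)
sign-isPositive -[1+ k ]  = cong -[1+_] (ℕ.+-identityʳ k)

basisSigns : ∀ {m} → Multiset m → Z2 m
basisSigns f = tabulate (λ i → isPositive (fourier f (basis i)))

normalise : ∀ {m} → Multiset m → Multiset m
normalise f = translate (basisSigns f) f

fourier-normalise-basis : ∀ {m} (f : Multiset m) i → fourier (normalise f) (basis i) ≡ - + ∣ fourier f (basis i) ∣
fourier-normalise-basis f i = begin
  fourier (normalise f) (basis i)
    ≡⟨ fourier-translate (basisSigns f) f (basis i) ⟩
  χ (basis i) (basisSigns f) *ℤ fourier f (basis i)
    ≡⟨ cong (λ b → sign b *ℤ fourier f (basis i)) (trans (dot-basis i _) (Vec.lookup∘tabulate _ i)) ⟩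
  sign (isPositive (fourier f (basis i))) *ℤ fourier f (basis i)
    ≡⟨ sign-isPositive (fourier f (basis i)) ⟩
  - + ∣ fourier f (basis i) ∣
    ∎

module StandardForm {n} (f₁ f₂ : Multiset (suc (suc n))) (I : Indistinguishable (suc (suc n)) f₁ f₂)
                    (fp≢ : fourierProduct f₁ ≢ fourierProduct f₂) where

  g₁ g₂ : Multiset (suc (suc n))
  g₁ = normalise f₁
  g₂ = normalise f₂

  S H : ℤ
  S = fourier f₁ zeros
  H = fourier g₁ hvec

  γ : Fin (suc (suc n)) → ℕ
  γ i = ∣ fourier f₁ (basis i) ∣

  γ>0 : ∀ i → 0 < γ i
  γ>0 i = ℕ.n≢0⇒n>0 (fourier-basis≢0 I fp≢ (s≤s (s≤s z≤n)) i ∘ ℤ.∣i∣≡0⇒i≡0)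

  private
    fourier²₁≡fourier²₂ : ∀ x → fourier f₁ x *ℤ fourier f₁ x ≡ fourier f₂ x *ℤ fourier f₂ x
    fourier²₁≡fourier²₂ = fourier²≡ I (s≤s (s≤s z≤n))

    normalise-vanishes : ∀ {f f′ : Multiset (suc (suc n))} → Indistinguishable _ f f′ → fourierProduct f ≢ fourierProduct f′ →
                         ∀ x → x ∉ specialPoints _ → fourier (normalise f) x ≡ 0ℤ
    normalise-vanishes {f} I fp≢ x x∉ = begin
      fourier (normalise f) x            ≡⟨ fourier-translate (basisSigns f) f x ⟩
      χ x (basisSigns f) *ℤ fourier f x  ≡⟨ cong (χ x (basisSigns f) *ℤ_) (fourier-vanishes I fp≢ x 2≤w w<m) ⟩
      χ x (basisSigns f) *ℤ 0ℤ           ≡⟨ ℤ.*-zeroʳ (χ x (basisSigns f)) ⟩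
      0ℤ                                 ∎
      where
      2≤w = proj₁ (∉specialPoints⇒ x x∉)
      w<m = proj₂ (∉specialPoints⇒ x x∉)

    ĝ₂-basis : ∀ i → fourier g₂ (basis i) ≡ - + γ i
    ĝ₂-basis i = trans (fourier-normalise-basis f₂ i)
                       (cong (λ v → - + v) (sym (sq≡⇒∣∣≡ (fourier f₁ (basis i)) (fourier f₂ (basis i)) (fourier²₁≡fourier²₂ (basis i)))))

    H≢ĝ₂ : H ≢ fourier g₂ hvec
    H≢ĝ₂ H≡ĝ₂ = fp≢ (begin
      fourierProduct f₁                                   ≡⟨ sym (fourierProduct-translate (basisSigns f₁) f₁) ⟩
      fourierProduct g₁                                   ≡⟨ fourierProduct-∏ g₁ ⟩
      ∏ (fourier g₁) (tabulate basis) *ℤ H                ≡⟨ cong₂ _*ℤ_ (∏-tabulate-cong (fourier g₁) (fourier g₂) basis ĝ₁≡ĝ₂) H≡ĝ₂ ⟩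
      ∏ (fourier g₂) (tabulate basis) *ℤ fourier g₂ hvec  ≡⟨ sym (fourierProduct-∏ g₂) ⟩
      fourierProduct g₂                                   ≡⟨ fourierProduct-translate (basisSigns f₂) f₂ ⟩
      fourierProduct f₂                                   ∎)
      where
      ĝ₁≡ĝ₂ : ∀ i → fourier g₁ (basis i) ≡ fourier g₂ (basis i)
      ĝ₁≡ĝ₂ i = trans (fourier-normalise-basis f₁ i) (sym (ĝ₂-basis i))

    ĝ₂-hvec : fourier g₂ hvec ≡ - H
    ĝ₂-hvec = sq≡∧≢⇒≡- H (fourier g₂ hvec) squares H≢ĝ₂
      where
      squares : H *ℤ H ≡ fourier g₂ hvec *ℤ fourier g₂ hvec
      squares = trans (fourier-translate-sq (basisSigns f₁) f₁ hvec)
                      (trans (fourier²₁≡fourier²₂ hvec) (sym (fourier-translate-sq (basisSigns f₂) f₂ hvec)))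

  H≢0 : H ≢ 0ℤ
  H≢0 H≡0 = H≢ĝ₂ (trans H≡0 (sym (trans ĝ₂-hvec (cong -_ H≡0))))

  spectrum₁ : ∀ y → + 2 ^ suc (suc n) *ℤ + g₁ y ≡ spectral S H (λ i → - + γ i) y
  spectrum₁ = sparse-fourier-inversion g₁ {S} {H} {λ i → - + γ i} (normalise-vanishes I fp≢)
                                       (fourier-translate-zeros (basisSigns f₁) f₁) refl (fourier-normalise-basis f₁)

  spectrum₂ : ∀ y → + 2 ^ suc (suc n) *ℤ + g₂ y ≡ spectral S (- H) (λ i → - + γ i) y
  spectrum₂ = sparse-fourier-inversion g₂ {S} { - H} {λ i → - + γ i} (normalise-vanishes (indistinguishable-sym I) (fp≢ ∘ sym))
                                       (trans (fourier-translate-zeros (basisSigns f₂) f₂) (sym (fourier-zeros≡ I (s≤s z≤n))))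
                                       ĝ₂-hvec ĝ₂-basis

theorem4p4 : (k : ℕ) → 3 ≤ k → (f₁ f₂ : Multiset (k ∸ 1)) →
    DistinguishingNumber f₁ f₂ k →
    ¬ (fourierProduct f₁ ≡ fourierProduct f₂) →
    ∃[ a ] ∃[ b ] ∃[ as ] ∃[ x₁ ] ∃[ x₂ ]
      (¬ (a ≡ b) × All (λ aᵢ → 0 < aᵢ) as ×
       (∀ y → translate x₁ f₁ y ≡ fShape {k ∸ 1} a b as y) ×
       (∀ y → translate x₂ f₂ y ≡ fShape {k ∸ 1} b a as y))
theorem4p4 0                 ()                   _  _  _  _
theorem4p4 1                 (s≤s ())             _  _  _  _
theorem4p4 2                 (s≤s (s≤s ()))       _  _  _  _
theorem4p4 (suc (suc (suc n))) _ f₁ f₂ dn fp≢ =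
  let a , b , as , a≢b , as>0 , shape₁ , shape₂ =
        fShape-from-spectral (2 ^ suc (suc n)) {{ℕ.m^n≢0 2 (suc (suc n))}} S H γ g₁ g₂ H≢0 γ>0 spectrum₁ spectrum₂
  in a , b , as , basisSigns f₁ , basisSigns f₂ , a≢b , as>0 , shape₁ , shape₂
  where open StandardForm f₁ f₂ (indistinguishable-below dn) fp≢
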